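{- Let $\mathcal{G}$ be a hereditary graph class containing $K_2$ with $\mathrm{mad}(G)\le d$ for all $G\in\mathcal{G}$. Then for every graph $H$, $c^{\mathcal{G}}_{\mathrm u}(H)\le 2d\cdot\bigl(c^{\mathcal{G}}_{\mathrm f}(H)\bigr)^2$. In particular, for such $\mathcal{G}$, every class $\mathcal{H}$ of graphs is $(c^{\mathcal{G}}_{\mathrm u},c^{\mathcal{G}}_{\mathrm f})$-bounded.
   Context: All graphs are finite and simple. A class is hereditary if closed under induced subgraphs. $\mathrm{mad}(G)=\max\{2|E(G')|/|V(G')| : G'\subseteq G,\ |V(G')|>0\}$. For graphs $G,H$, a homomorphism $\varphi\colon G\to H$ is a map $V(G)\to V(H)$ with $\varphi(u)\varphi(v)\in E(H)$ whenever $uv\in E(G)$. $\dot\cup$ denotes vertex-disjoint union. For a graph class $\mathcal{G}$ and a graph $H$, a $\mathcal{G}$-cover of $H$ is an edge-surjective homomorphism $\varphi\colon G_1\dot\cup\cdots\dot\cup G_t\to H$ with all $G_i\in\mathcal{G}$; it is called $t$-global, injective if each $\varphi|_{G_i}$ is injective, and $s$-local if $|\varphi^{ -1}(v)|\le s$ for all $v\in V(H)$. $\overline{\mathcal{G}}$ is the class of all vertex-disjoint unions of graphs in $\mathcal{G}$. $c^{\mathcal{G}}_{\mathrm u}(H)$ is the least $t$ such that $H$ has a $t$-global injective $\overline{\mathcal{G}}$-cover; $c^{\mathcal{G}}_{\mathrm f}(H)$ the least $s$ such that $H$ has an $s$-local (not necessarily injective) $\mathcal{G}$-cover. $\mathcal{H}$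 is $(c^{\mathcal{G}}_{\mathrm u},c^{\mathcal{G}}_{\mathrm f})$-bounded if there is $f\colon\mathbb{N}\to\mathbb{R}_{\ge0}$ with $c^{\mathcal{G}}_{\mathrm f}(H)\le c^{\mathcal{G}}_{\mathrm u}(H)\le f(c^{\mathcal{G}}_{\mathrm f}(H))$ for all $H\in\mathcal{H}$.
   Formalization: The bound d on the maximum average degree of the graphs in 𝒢 ranges over the rationals. -}

module Defs where

open import Data.Nat as ℕ using (ℕ; zero; suc; _+_; _<_)
open import Data.Bool using (Bool; true; false; if_then_else_)
open import Data.Fin using (Fin; zero; suc; toℕ; splitAt)
open import Data.Fin.Properties using (_≟_)
open import Data.Sum using (_⊎_; inj₁; inj₂)
open import Data.Product using (Σ; ∃; _×_; _,_)
open import Data.List using (List; []; _∷_)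
open import Data.Integer using (+_)
open import Data.Rational as ℚ using (ℚ; _/_)
open import Relation.Nullary using (¬_; does)
open import Relation.Binary.PropositionalEquality using (_≡_; refl)
open import Function.Definitions using (Injective)

record Graph : Set where
  field
    n      : ℕ
    adj    : Fin n → Fin n → Bool
    sym    : ∀ u v → adj u v ≡ adj v u
    irrefl : ∀ v → adj v v ≡ false
open Graph public

E : (G : Graph) → Fin (n G) → Fin (n G) → Set
E G u v = adj G u v ≡ true

GraphClass : Set₁
GraphClass = Graph → Set

count : (m : ℕ) → (Fin m → Bool) → ℕ
count zero    p = 0
count (suc m) p = (if p zero then 1 else 0) + count m (λ i → p (suc i))

sumFin : (m : ℕ) → (Fin m → ℕ) → ℕ
sumFin zero    f = 0
sumFin (suc m) f = f zero + sumFin m (λ i → f (suc i))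

numEdges : Graph → ℕ
numEdges G = sumFin (n G) λ u → count (n G) λ v →
  if does (toℕ u ℕ.<? toℕ v) then adj G u v else false

IsHom : (G H : Graph) → (Fin (n G) → Fin (n H)) → Set
IsHom G H φ = ∀ x y → E G x y → E H (φ x) (φ y)

-- G' is (isomorphic to) a subgraph of G: injective homomorphism G' → G
_⊆_ : Graph → Graph → Set
G' ⊆ G = Σ (Fin (n G') → Fin (n G)) λ f → Injective _≡_ _≡_ f × IsHom G' G f

-- F is (isomorphic to) an induced subgraph of G
_⊆ᵢ_ : Graph → Graph → Set
F ⊆ᵢ G = Σ (Fin (n F) → Fin (n G)) λ f →
  Injective _≡_ _≡_ f × (∀ x y → adj F x y ≡ adj G (f x) (f y))

_≅_ : Graph → Graph → Set
F ≅ G = Σ (Fin (n F) → Fin (n G)) λ f → Σ (Fin (n G) → Fin (n F)) λ g →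
  (∀ x → g (f x) ≡ x) × (∀ y → f (g y) ≡ y) ×
  (∀ x y → adj F x y ≡ adj G (f x) (f y))

Hereditary : GraphClass → Set
Hereditary 𝒢 = ∀ G F → 𝒢 G → F ⊆ᵢ G → 𝒢 F

K₂ : Graph
K₂ = record { n = 2 ; adj = a ; sym = s ; irrefl = i }
  where
  a : Fin 2 → Fin 2 → Bool
  a u v = if does (u ≟ v) then false else true
  s : ∀ u v → a u v ≡ a v u
  s zero zero = refl
  s zero (suc zero) = refl
  s (suc zero) zero = refl
  s (suc zero) (suc zero) = refl
  i : ∀ v → a v v ≡ false
  i zero = refl
  i (suc zero) = refl

emptyGraph : Graph
emptyGraph = record { n = 0 ; adj = λ () ; sym = λ () ; irrefl = λ () }

-- vertex-disjoint union of two graphs (vertices of G first, then H)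
unionAdj : (G H : Graph) → Fin (n G + n H) → Fin (n G + n H) → Bool
unionAdj G H u v with splitAt (n G) u | splitAt (n G) v
... | inj₁ a | inj₁ b = adj G a b
... | inj₂ a | inj₂ b = adj H a b
... | inj₁ _ | inj₂ _ = false
... | inj₂ _ | inj₁ _ = false

unionSym : (G H : Graph) → ∀ u v → unionAdj G H u v ≡ unionAdj G H v u
unionSym G H u v with splitAt (n G) u | splitAt (n G) v
... | inj₁ a | inj₁ b = sym G a b
... | inj₂ a | inj₂ b = sym H a b
... | inj₁ _ | inj₂ _ = refl
... | inj₂ _ | inj₁ _ = refl

unionIrrefl : (G H : Graph) → ∀ v → unionAdj G H v v ≡ false
unionIrrefl G H v with splitAt (n G) v
... | inj₁ a = irrefl G a
... | inj₂ a = irrefl H a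

_⊕_ : Graph → Graph → Graph
G ⊕ H = record { n = n G + n H ; adj = unionAdj G H
               ; sym = unionSym G H ; irrefl = unionIrrefl G H }

⨁ : List Graph → Graph
⨁ []       = emptyGraph
⨁ (G ∷ Gs) = G ⊕ ⨁ Gs

data AllIn (𝒢 : GraphClass) : List Graph → Set where
  []  : AllIn 𝒢 []
  _∷_ : ∀ {G Gs} → 𝒢 G → AllIn 𝒢 Gs → AllIn 𝒢 (G ∷ Gs)

-- 𝒢̄: all vertex-disjoint unions of (finitely many) graphs in 𝒢
closure : GraphClass → GraphClass
closure 𝒢 F = Σ (List Graph) λ Gs → AllIn 𝒢 Gs × (F ≅ ⨁ Gs)

-- maximum average degree bound:  mad(G) ≤ d, i.e.
-- 2|E(G')|/|V(G')| ≤ d for every subgraph G' of G with |V(G')| > 0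

ℕtoℚ : ℕ → ℚ
ℕtoℚ k = + k / 1

MadAtMost : ℚ → Graph → Set
MadAtMost d G = ∀ G' → G' ⊆ G → 0 < n G' →
  ℕtoℚ (2 ℕ.* numEdges G') ℚ.≤ d ℚ.* ℕtoℚ (n G')

-- Covers.  A family of t graphs G₁,…,G_t with maps φᵢ into H;
-- the union φ : G₁ ∪̇ … ∪̇ G_t → H is given componentwise.

record Cover (𝒢 : GraphClass) (H : Graph) : Set where
  field
    t     : ℕ
    comp  : Fin t → Graph
    inCls : ∀ i → 𝒢 (comp i)
    φ     : ∀ i → Fin (n (comp i)) → Fin (n H)
    hom   : ∀ i → IsHom (comp i) H (φ i)
    surj  : ∀ u v → E H u v →
            Σ (Fin t) λ i → Σ (Fin (n (comp i))) λ x → Σ (Fin (n (comp i))) λ y →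
              E (comp i) x y × φ i x ≡ u × φ i y ≡ v
open Cover public

preimageSize : ∀ {𝒢 H} → Cover 𝒢 H → Fin (n H) → ℕ
preimageSize C v = sumFin (t C) λ i → count (n (comp C i)) λ x → does (φ C i x ≟ v)

IsLocal : ∀ {𝒢 H} → ℕ → Cover 𝒢 H → Set
IsLocal s C = ∀ v → preimageSize C v ℕ.≤ s

IsInjective : ∀ {𝒢 H} → Cover 𝒢 H → Set
IsInjective C = ∀ i → Injective _≡_ _≡_ (φ C i)

HasLocalCover : GraphClass → Graph → ℕ → Set
HasLocalCover 𝒢 H s = Σ (Cover 𝒢 H) λ C → IsLocal s C

HasGlobalInjCover : GraphClass → Graph → ℕ → Set
HasGlobalInjCover 𝒢 H k = Σ (Cover (closure 𝒢) H) λ C → t C ≡ k × IsInjective C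

IsLeast : (ℕ → Set) → ℕ → Set
IsLeast P k = P k × (∀ m → P m → k ℕ.≤ m)

IsCf : GraphClass → Graph → ℕ → Set
IsCf 𝒢 H = IsLeast (HasLocalCover 𝒢 H)

IsCu : GraphClass → Graph → ℕ → Set
IsCu 𝒢 H = IsLeast (HasGlobalInjCover 𝒢 H)

CuCfBounded : GraphClass → GraphClass → Set
CuCfBounded 𝒢 ℋ = Σ (ℕ → ℚ) λ f → (∀ k → ℚ.0ℚ ℚ.≤ f k) ×
  (∀ H → ℋ H → ∀ s u → IsCf 𝒢 H s → IsCu 𝒢 H u →
     s ℕ.≤ u × ℕtoℚ u ℚ.≤ f s)

{-# OPTIONS --safe #-}
module Submission where

-- Let φ : D → H be an s-local 𝒢-cover, D the disjoint union of its components.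
-- Numbering the vertices of every fibre 0, 1, … (their rank) gives each vertex a
-- rank below s, and the vertices of any fixed rank map injectively to H.  For ranks
-- a < b, the images of the D-edges between vertices of rank a or b form a graph
-- Q_ab on V(H); every vertex of H has at most two such preimages and D has
-- mad ≤ d, so Q_ab has mad ≤ 2d and is properly (⌊2d⌋+1)-coloured greedily.  For
-- each colour c, keeping the rank-a vertex over c-coloured vertices and the rank-b
-- vertex elsewhere is again injective on fibres, and these choices cover all a–b
-- edges.  By heredity, the subgraph of D induced by each such choice is a union of
-- graphs in 𝒢, so s + (s choose 2)(⌊2d⌋+1) ≤ 2d·s² injective pieces cover H
-- (d ≥ 1 since K₂ ∈ 𝒢).  Conversely, cutting the components of an injective
-- t-global cover into their 𝒢-pieces yields a t-local 𝒢-cover, so c_f ≤ c_u.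

open import Defs hiding (sym)
open import Data.Nat as ℕ using (ℕ; zero; suc; _+_; _*_; _≤_; _<_; z≤n; s≤s)
import Data.Nat.Properties as NP
open import Data.Nat.Solver using (module +-*-Solver)
open import Data.Bool using (Bool; true; false; if_then_else_; _∧_; _∨_; not)
import Data.Bool as Bool
open import Data.Bool.Properties
  using (∧-zeroʳ; ∧-assoc; ∧-conicalˡ; ∧-conicalʳ; ∧-distribˡ-∨; ∨-zeroʳ; ∧-commutativeMonoid)
open import Data.Fin as F using (Fin; zero; suc; toℕ; splitAt; _↑ˡ_; _↑ʳ_)
open import Data.Fin.Properties
  using (_≟_; any?; splitAt-↑ˡ; splitAt-↑ʳ; splitAt⁻¹-↑ˡ; splitAt⁻¹-↑ʳ; ↑ˡ-injective; ↑ʳ-injective)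
import Data.Fin.Properties as FP
open import Data.Sum using (inj₁; inj₂; [_,_]′)
open import Data.Product using (Σ; _×_; _,_; proj₁; proj₂; swap)
open import Data.List as L using (List; []; _∷_; _++_)
import Data.List.Properties as LP
open import Data.List.Membership.Propositional using (_∈_; lose)
open import Data.List.Membership.Propositional.Properties using (∈-++⁺ˡ; ∈-++⁺ʳ; ∈-map⁺; ∈-upTo⁺)
open import Data.List.Relation.Unary.Any as Any using (Any)
import Data.List.Relation.Unary.Any.Properties as AnyP
open import Data.Empty using (⊥-elim)
open import Data.Integer as ℤ using (ℤ; -[1+_]) renaming (+_ to +ℤ)
import Data.Integer.Properties as ZP
import Data.Nat.Coprimality as Cop
open import Data.Rational as ℚ using (ℚ)
import Data.Rational.Properties as QP
import Data.Rational.Unnormalised as ℚᵘ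
import Data.Rational.Unnormalised.Properties as QUP
open import Relation.Binary using (tri<; tri≈; tri>)
open import Relation.Nullary using (does; Dec; yes; no)
open import Relation.Nullary.Decidable using (dec-true; dec-false; _×-dec_)
open import Relation.Binary.PropositionalEquality
  using (_≡_; _≢_; refl; sym; trans; cong; cong₂; subst; subst₂; module ≡-Reasoning)
open import Function using (_∘_; id)
open import Algebra.Bundles using (CommutativeMonoid)
open import Algebra.Properties.CommutativeSemigroup NP.+-commutativeSemigroup using (interchange)
open import Algebra.Properties.CommutativeSemigroup NP.*-commutativeSemigroup using (x∙yz≈y∙xz)
open import Algebra.Properties.CommutativeSemigroup (CommutativeMonoid.commutativeSemigroup ∧-commutativeMonoid)
  using () renaming (x∙yz≈y∙xz to ∧-left-comm)

dec-true⁻¹ : ∀ {a} {A : Set a} (a? : Dec A) → does a? ≡ true → A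
dec-true⁻¹ (yes a) _ = a

𝟙 : Bool → ℕ
𝟙 b = if b then 1 else 0

𝟙-∧ : ∀ a b → 𝟙 (a ∧ b) ≡ 𝟙 a * 𝟙 b
𝟙-∧ false b = refl
𝟙-∧ true  b = sym (NP.+-identityʳ (𝟙 b))

𝟙-mono : ∀ {a b} → (a ≡ true → b ≡ true) → 𝟙 a ≤ 𝟙 b
𝟙-mono {false}         _   = z≤n
𝟙-mono {true}  {true}  _   = NP.≤-refl
𝟙-mono {true}  {false} a⇒b with () ← a⇒b refl

𝟙-∨ : ∀ a b → 𝟙 (a ∨ b) ≤ 𝟙 a + 𝟙 b
𝟙-∨ false b = NP.≤-refl
𝟙-∨ true  b = s≤s z≤n

sum-cong : ∀ m {f g : Fin m → ℕ} → (∀ i → f i ≡ g i) → sumFin m f ≡ sumFin m g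
sum-cong zero    f≗g = refl
sum-cong (suc m) f≗g = cong₂ _+_ (f≗g zero) (sum-cong m (f≗g ∘ suc))

sum-mono : ∀ m {f g : Fin m → ℕ} → (∀ i → f i ≤ g i) → sumFin m f ≤ sumFin m g
sum-mono zero    f≤g = z≤n
sum-mono (suc m) f≤g = NP.+-mono-≤ (f≤g zero) (sum-mono m (f≤g ∘ suc))

sum-mono-< : ∀ m {f g : Fin m → ℕ} → (∀ i → f i ≤ g i) → ∀ i → f i < g i → sumFin m f < sumFin m g
sum-mono-< (suc m) f≤g zero    f<g = NP.+-mono-<-≤ f<g (sum-mono m (f≤g ∘ suc))
sum-mono-< (suc m) f≤g (suc i) f<g = NP.+-mono-≤-< (f≤g zero) (sum-mono-< m (f≤g ∘ suc) i f<g)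

sum-zeros : ∀ m {f : Fin m → ℕ} → (∀ i → f i ≡ 0) → sumFin m f ≡ 0
sum-zeros zero    f≗0 = refl
sum-zeros (suc m) f≗0 = cong₂ _+_ (f≗0 zero) (sum-zeros m (f≗0 ∘ suc))

sum-+ : ∀ m (f g : Fin m → ℕ) → sumFin m (λ i → f i + g i) ≡ sumFin m f + sumFin m g
sum-+ zero    f g = refl
sum-+ (suc m) f g = trans (cong (f zero + g zero +_) (sum-+ m (f ∘ suc) (g ∘ suc)))
                          (interchange (f zero) (g zero) _ _)

sum-*ˡ : ∀ m c (f : Fin m → ℕ) → sumFin m (λ i → c * f i) ≡ c * sumFin m f
sum-*ˡ zero    c f = sym (NP.*-zeroʳ c)
sum-*ˡ (suc m) c f = trans (cong (c * f zero +_) (sum-*ˡ m c (f ∘ suc)))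
                           (sym (NP.*-distribˡ-+ c (f zero) _))

sum-swap : ∀ m k (f : Fin m → Fin k → ℕ) →
  sumFin m (λ i → sumFin k (f i)) ≡ sumFin k (λ j → sumFin m (λ i → f i j))
sum-swap zero    k f = sym (sum-zeros k (λ _ → refl))
sum-swap (suc m) k f = trans (cong (sumFin k (f zero) +_) (sum-swap m k (f ∘ suc)))
                             (sym (sum-+ k (f zero) (λ j → sumFin m (λ i → f (suc i) j))))

sum-↑ : ∀ m k (f : Fin (m + k) → ℕ) →
  sumFin (m + k) f ≡ sumFin m (λ i → f (i ↑ˡ k)) + sumFin k (λ j → f (m ↑ʳ j))
sum-↑ zero    k f = refl
sum-↑ (suc m) k f = trans (cong (f zero +_) (sum-↑ m k (f ∘ suc))) (sym (NP.+-assoc (f zero) _ _))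

≤-sum : ∀ m (f : Fin m → ℕ) i → f i ≤ sumFin m f
≤-sum (suc m) f zero    = NP.m≤m+n (f zero) _
≤-sum (suc m) f (suc i) = NP.m≤n⇒m≤o+n (f zero) (≤-sum m (f ∘ suc) i)

sum-≤-* : ∀ m c {f : Fin m → ℕ} → (∀ i → f i ≤ c) → sumFin m f ≤ m * c
sum-≤-* zero    c f≤c = z≤n
sum-≤-* (suc m) c f≤c = NP.+-mono-≤ (f≤c zero) (sum-≤-* m c (f≤c ∘ suc))

*≤sum : ∀ m c {f : Fin m → ℕ} → (∀ i → c ≤ f i) → m * c ≤ sumFin m f
*≤sum zero    c c≤f = z≤n
*≤sum (suc m) c c≤f = NP.+-mono-≤ (c≤f zero) (*≤sum m c (c≤f ∘ suc))

sum-concentrated : ∀ m (f : Fin m → ℕ) i → (∀ j → i ≢ j → f j ≡ 0) → sumFin m f ≡ f i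
sum-concentrated (suc m) f zero    off =
  trans (cong (f zero +_) (sum-zeros m (λ j → off (suc j) λ ()))) (NP.+-identityʳ (f zero))
sum-concentrated (suc m) f (suc i) off =
  trans (cong (_+ sumFin m (f ∘ suc)) (off zero λ ()))
        (sum-concentrated m (f ∘ suc) i (λ j i≢j → off (suc j) (i≢j ∘ FP.suc-injective)))

sum-𝟙≟ : ∀ m (i : Fin m) (f : Fin m → ℕ) → sumFin m (λ j → f j * 𝟙 (does (i ≟ j))) ≡ f i
sum-𝟙≟ m i f = begin
  sumFin m (λ j → f j * 𝟙 (does (i ≟ j))) ≡⟨ sum-concentrated m _ i off ⟩
  f i * 𝟙 (does (i ≟ i))                 ≡⟨ cong (λ b → f i * 𝟙 b) (dec-true (i ≟ i) refl) ⟩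
  f i * 1                                ≡⟨ NP.*-identityʳ (f i) ⟩
  f i                                    ∎
  where
  open ≡-Reasoning
  off : ∀ j → i ≢ j → f j * 𝟙 (does (i ≟ j)) ≡ 0
  off j i≢j with i ≟ j
  ... | yes i≡j = ⊥-elim (i≢j i≡j)
  ... | no  _   = NP.*-zeroʳ (f j)

sum-*-sum-comm : ∀ m k (a : Fin m → ℕ) (b : Fin k → ℕ) (c : Fin k → Fin m → ℕ) →
  sumFin m (λ v → a v * sumFin k (λ x → b x * c x v)) ≡ sumFin k (λ x → b x * sumFin m (λ v → a v * c x v))
sum-*-sum-comm m k a b c = begin
  sumFin m (λ v → a v * sumFin k (λ x → b x * c x v))
    ≡⟨ sum-cong m (λ v → sum-*ˡ k (a v) _) ⟨
  sumFin m (λ v → sumFin k (λ x → a v * (b x * c x v)))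
    ≡⟨ sum-swap m k _ ⟩
  sumFin k (λ x → sumFin m (λ v → a v * (b x * c x v)))
    ≡⟨ sum-cong k (λ x → sum-cong m (λ v → x∙yz≈y∙xz (a v) (b x) (c x v))) ⟩
  sumFin k (λ x → sumFin m (λ v → b x * (a v * c x v)))
    ≡⟨ sum-cong k (λ x → sum-*ˡ m (b x) _) ⟩
  sumFin k (λ x → b x * sumFin m (λ v → a v * c x v)) ∎
  where open ≡-Reasoning

sum-fibres : ∀ {M N} (ψ : Fin M → Fin N) (g : Fin N → ℕ) (h : Fin M → ℕ) →
  sumFin N (λ w → g w * sumFin M (λ x → 𝟙 (does (ψ x ≟ w)) * h x)) ≡ sumFin M (λ x → g (ψ x) * h x)
sum-fibres {M} {N} ψ g h = begin
  sumFin N (λ w → g w * sumFin M (λ x → 𝟙 (does (ψ x ≟ w)) * h x))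
    ≡⟨ sum-cong N (λ w → cong (g w *_) (sum-cong M (λ x → NP.*-comm _ (h x)))) ⟩
  sumFin N (λ w → g w * sumFin M (λ x → h x * 𝟙 (does (ψ x ≟ w))))
    ≡⟨ sum-*-sum-comm N M g h (λ x w → 𝟙 (does (ψ x ≟ w))) ⟩
  sumFin M (λ x → h x * sumFin N (λ w → g w * 𝟙 (does (ψ x ≟ w))))
    ≡⟨ sum-cong M (λ x → trans (cong (h x *_) (sum-𝟙≟ N (ψ x) g)) (NP.*-comm (h x) _)) ⟩
  sumFin M (λ x → g (ψ x) * h x) ∎
  where open ≡-Reasoning

count≡sum : ∀ m (p : Fin m → Bool) → count m p ≡ sumFin m (𝟙 ∘ p)
count≡sum zero    p = refl
count≡sum (suc m) p = cong (𝟙 (p zero) +_) (count≡sum m (p ∘ suc))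

count-cong : ∀ m {p q : Fin m → Bool} → (∀ i → p i ≡ q i) → count m p ≡ count m q
count-cong m {p} {q} p≗q = begin
  count m p          ≡⟨ count≡sum m p ⟩
  sumFin m (𝟙 ∘ p)   ≡⟨ sum-cong m (cong 𝟙 ∘ p≗q) ⟩
  sumFin m (𝟙 ∘ q)   ≡⟨ count≡sum m q ⟨
  count m q          ∎
  where open ≡-Reasoning

count≤ : ∀ m (p : Fin m → Bool) → count m p ≤ m
count≤ zero    p = z≤n
count≤ (suc m) p with p zero
... | true  = s≤s (count≤ m (p ∘ suc))
... | false = NP.m≤n⇒m≤1+n (count≤ m (p ∘ suc))

count-mono-< : ∀ m {p q : Fin m → Bool} → (∀ i → p i ≡ true → q i ≡ true) →
  ∀ i → p i ≡ false → q i ≡ true → count m p < count m q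
count-mono-< m {p} {q} p⇒q i pᵢ qᵢ = subst₂ _<_ (sym (count≡sum m p)) (sym (count≡sum m q))
  (sum-mono-< m (λ j → 𝟙-mono (p⇒q j)) i (subst₂ (λ a b → 𝟙 a < 𝟙 b) (sym pᵢ) (sym qᵢ) (s≤s z≤n)))

count-∨ : ∀ m (p q : Fin m → Bool) → count m (λ i → p i ∨ q i) ≤ count m p + count m q
count-∨ m p q = begin
  count m (λ i → p i ∨ q i)                  ≡⟨ count≡sum m _ ⟩
  sumFin m (λ i → 𝟙 (p i ∨ q i))             ≤⟨ sum-mono m (λ i → 𝟙-∨ (p i) (q i)) ⟩
  sumFin m (λ i → 𝟙 (p i) + 𝟙 (q i))         ≡⟨ sum-+ m (𝟙 ∘ p) (𝟙 ∘ q) ⟩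
  sumFin m (𝟙 ∘ p) + sumFin m (𝟙 ∘ q)        ≡⟨ cong₂ _+_ (count≡sum m p) (count≡sum m q) ⟨
  count m p + count m q                      ∎
  where open NP.≤-Reasoning

count≡0⇒false : ∀ m {p : Fin m → Bool} → count m p ≡ 0 → ∀ i → p i ≡ false
count≡0⇒false (suc m) {p} #p≡0 i with p zero in p₀ | i
... | false | zero  = p₀
... | false | suc i = count≡0⇒false m #p≡0 i

false⇒count≡0 : ∀ m {p : Fin m → Bool} → (∀ i → p i ≡ false) → count m p ≡ 0
false⇒count≡0 m {p} p≗false = trans (count≡sum m p) (sum-zeros m (λ i → cong 𝟙 (p≗false i)))

count-≤1 : ∀ m {p : Fin m → Bool} → (∀ i j → p i ≡ true → p j ≡ true → i ≡ j) → count m p ≤ 1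
count-≤1 zero    _    = z≤n
count-≤1 (suc m) {p} uniq with p zero in p₀
... | true  = NP.≤-reflexive (cong suc (false⇒count≡0 m rest))
  where
  rest : ∀ i → p (suc i) ≡ false
  rest i with p (suc i) in pᵢ
  ... | true  with () ← uniq zero (suc i) p₀ pᵢ
  ... | false = refl
... | false = count-≤1 m (λ i j pᵢ pⱼ → FP.suc-injective (uniq (suc i) (suc j) pᵢ pⱼ))

*-count≤sum : ∀ m c (p : Fin m → Bool) (f : Fin m → ℕ) → (∀ i → p i ≡ true → c ≤ f i) →
  c * count m p ≤ sumFin m f
*-count≤sum zero    c p f c≤f = NP.≤-reflexive (NP.*-zeroʳ c)
*-count≤sum (suc m) c p f c≤f with p zero in p₀
... | true  = NP.≤-trans (NP.≤-reflexive (NP.*-suc c _))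
                (NP.+-mono-≤ (c≤f zero p₀) (*-count≤sum m c (p ∘ suc) (f ∘ suc) (c≤f ∘ suc)))
... | false = NP.≤-trans (*-count≤sum m c (p ∘ suc) (f ∘ suc) (c≤f ∘ suc)) (NP.m≤n+m _ (f zero))

ℕtoℚ≡mkℚ : ∀ k → ℕtoℚ k ≡ ℚ.mkℚ (+ℤ k) 0 (Cop.sym (Cop.1-coprimeTo k))
ℕtoℚ≡mkℚ k = QP.normalize-coprime (Cop.sym (Cop.1-coprimeTo k))

ℕtoℚ-mono-≤ : ∀ {a b} → a ≤ b → ℕtoℚ a ℚ.≤ ℕtoℚ b
ℕtoℚ-mono-≤ {a} {b} a≤b rewrite ℕtoℚ≡mkℚ a | ℕtoℚ≡mkℚ b =
  ℚ.*≤* (subst₂ ℤ._≤_ (sym (ZP.*-identityʳ (+ℤ a))) (sym (ZP.*-identityʳ (+ℤ b))) (ℤ.+≤+ a≤b))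

toℚᵘ-ℕtoℚ : ∀ k → ℚ.toℚᵘ (ℕtoℚ k) ≡ ℚᵘ.mkℚᵘ (+ℤ k) 0
toℚᵘ-ℕtoℚ k rewrite ℕtoℚ≡mkℚ k = refl

-- ℚ's operations normalise their results, so the homomorphism laws are checked on
-- unnormalised representatives.
ℕtoℚ-+ : ∀ a b → ℕtoℚ (a + b) ≡ ℕtoℚ a ℚ.+ ℕtoℚ b
ℕtoℚ-+ a b = QP.toℚᵘ-injective (QUP.≃-trans homo (QUP.≃-sym (QP.toℚᵘ-homo-+ (ℕtoℚ a) (ℕtoℚ b))))
  where
  homo : ℚ.toℚᵘ (ℕtoℚ (a + b)) ℚᵘ.≃ ℚ.toℚᵘ (ℕtoℚ a) ℚᵘ.+ ℚ.toℚᵘ (ℕtoℚ b)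
  homo rewrite toℚᵘ-ℕtoℚ (a + b) | toℚᵘ-ℕtoℚ a | toℚᵘ-ℕtoℚ b = ℚᵘ.*≡* (begin
    +ℤ (a + b) ℤ.* +ℤ 1                              ≡⟨ ZP.*-identityʳ _ ⟩
    +ℤ (a + b)                                       ≡⟨ ZP.pos-+ a b ⟩
    +ℤ a ℤ.+ +ℤ b                                    ≡⟨ cong₂ ℤ._+_ (ZP.*-identityʳ (+ℤ a)) (ZP.*-identityʳ (+ℤ b)) ⟨
    +ℤ a ℤ.* +ℤ 1 ℤ.+ +ℤ b ℤ.* +ℤ 1                  ≡⟨ ZP.*-identityʳ _ ⟨
    (+ℤ a ℤ.* +ℤ 1 ℤ.+ +ℤ b ℤ.* +ℤ 1) ℤ.* +ℤ 1       ∎)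
    where open ≡-Reasoning

ℕtoℚ-* : ∀ a b → ℕtoℚ (a * b) ≡ ℕtoℚ a ℚ.* ℕtoℚ b
ℕtoℚ-* a b = QP.toℚᵘ-injective (QUP.≃-trans homo (QUP.≃-sym (QP.toℚᵘ-homo-* (ℕtoℚ a) (ℕtoℚ b))))
  where
  homo : ℚ.toℚᵘ (ℕtoℚ (a * b)) ℚᵘ.≃ ℚ.toℚᵘ (ℕtoℚ a) ℚᵘ.* ℚ.toℚᵘ (ℕtoℚ b)
  homo rewrite toℚᵘ-ℕtoℚ (a * b) | toℚᵘ-ℕtoℚ a | toℚᵘ-ℕtoℚ b =
    ℚᵘ.*≡* (trans (ZP.*-identityʳ _) (trans (ZP.pos-* a b) (sym (ZP.*-identityʳ _))))

ℕtoℚ-nonNeg : ∀ k → ℚ.NonNegative (ℕtoℚ k)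
ℕtoℚ-nonNeg k = QP.normalize-nonNeg k 1

ℕtoℚ-sum-≤ : ∀ (d : ℚ) m (a b : Fin m → ℕ) → (∀ i → ℕtoℚ (a i) ℚ.≤ d ℚ.* ℕtoℚ (b i)) →
  ℕtoℚ (sumFin m a) ℚ.≤ d ℚ.* ℕtoℚ (sumFin m b)
ℕtoℚ-sum-≤ d zero    a b a≤db = QP.≤-reflexive (sym (QP.*-zeroʳ d))
ℕtoℚ-sum-≤ d (suc m) a b a≤db = begin
  ℕtoℚ (a zero + sumFin m (a ∘ suc))
    ≡⟨ ℕtoℚ-+ (a zero) _ ⟩
  ℕtoℚ (a zero) ℚ.+ ℕtoℚ (sumFin m (a ∘ suc))
    ≤⟨ QP.+-mono-≤ (a≤db zero) (ℕtoℚ-sum-≤ d m (a ∘ suc) (b ∘ suc) (a≤db ∘ suc)) ⟩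
  d ℚ.* ℕtoℚ (b zero) ℚ.+ d ℚ.* ℕtoℚ (sumFin m (b ∘ suc))
    ≡⟨ QP.*-distribˡ-+ d _ _ ⟨
  d ℚ.* (ℕtoℚ (b zero) ℚ.+ ℕtoℚ (sumFin m (b ∘ suc)))
    ≡⟨ cong (d ℚ.*_) (ℕtoℚ-+ (b zero) _) ⟨
  d ℚ.* ℕtoℚ (b zero + sumFin m (b ∘ suc)) ∎
  where open QP.≤-Reasoning

*-cancelʳ-≤-ℕtoℚ : ∀ {p q : ℚ} k → 0 < k → p ℚ.* ℕtoℚ k ℚ.≤ q ℚ.* ℕtoℚ k → p ℚ.≤ q
*-cancelʳ-≤-ℕtoℚ (suc k) _ = QP.*-cancelʳ-≤-pos (ℕtoℚ (suc k)) {{QP.normalize-pos (suc k) 1}}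

ℕtoℚ-unbounded : ∀ q → Σ ℕ λ B → q ℚ.< ℕtoℚ B
ℕtoℚ-unbounded q@(ℚ.mkℚ num den-1 _) = suc ℤ.∣ num ∣ , q<B
  where
  B = suc ℤ.∣ num ∣
  q<B : q ℚ.< ℕtoℚ B
  q<B rewrite ℕtoℚ≡mkℚ B = ℚ.*<* (begin-strict
    num ℤ.* +ℤ 1            ≡⟨ ZP.*-identityʳ num ⟩
    num                     ≤⟨ i≤+∣i∣ num ⟩
    +ℤ ℤ.∣ num ∣            <⟨ ℤ.+<+ (NP.n<1+n _) ⟩
    +ℤ B                    ≤⟨ ℤ.+≤+ (NP.m≤m*n B (suc den-1)) ⟩
    +ℤ (B * suc den-1)      ≡⟨ ZP.pos-* B (suc den-1) ⟩
    +ℤ B ℤ.* +ℤ (suc den-1) ∎)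
    where
    open ZP.≤-Reasoning
    i≤+∣i∣ : ∀ i → i ℤ.≤ +ℤ ℤ.∣ i ∣
    i≤+∣i∣ (+ℤ k)    = ZP.≤-refl
    i≤+∣i∣ -[1+ k ] = ℤ.-≤+

ℕtoℚ-floor : ∀ q → ℚ.0ℚ ℚ.≤ q → Σ ℕ λ r → ℕtoℚ r ℚ.≤ q × q ℚ.< ℕtoℚ (suc r)
ℕtoℚ-floor q 0≤q = below (proj₁ (ℕtoℚ-unbounded q)) (proj₂ (ℕtoℚ-unbounded q))
  where
  below : ∀ B → q ℚ.< ℕtoℚ B → Σ ℕ λ r → ℕtoℚ r ℚ.≤ q × q ℚ.< ℕtoℚ (suc r)
  below zero    q<0 = ⊥-elim (QP.<-irrefl refl (QP.≤-<-trans 0≤q q<0))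
  below (suc B) q<B with ℕtoℚ B QP.≤? q
  ... | yes B≤q = B , B≤q , q<B
  ... | no  B≰q = below B (QP.≰⇒> B≰q)

1≤q<1+r⇒1≤r : ∀ {q} r → ℚ.1ℚ ℚ.≤ q → q ℚ.< ℕtoℚ (suc r) → 1 ≤ r
1≤q<1+r⇒1≤r zero    1≤q q<1 = ⊥-elim (QP.<-irrefl refl (QP.≤-<-trans 1≤q q<1))
1≤q<1+r⇒1≤r (suc r) _   _   = s≤s z≤n

hom-separates : ∀ {G H φ} → IsHom G H φ → ∀ x y → E G x y → φ x ≢ φ y
hom-separates {G} {H} {φ} φ-hom x y e φx≡φy with () ←
  trans (sym (φ-hom x y e)) (trans (cong (λ w → adj H w (φ y)) φx≡φy) (irrefl H (φ y)))

⊆-refl : ∀ G → G ⊆ G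
⊆-refl G = (λ x → x) , (λ e → e) , (λ _ _ e → e)

enum : ∀ m (p : Fin m → Bool) → Fin (count m p) → Fin m
enum (suc m) p k with p zero
enum (suc m) p zero    | true  = zero
enum (suc m) p (suc k) | true  = suc (enum m (p ∘ suc) k)
enum (suc m) p k       | false = suc (enum m (p ∘ suc) k)

enum-true : ∀ m (p : Fin m → Bool) k → p (enum m p k) ≡ true
enum-true (suc m) p k with p zero in p₀
enum-true (suc m) p zero    | true  = p₀
enum-true (suc m) p (suc k) | true  = enum-true m (p ∘ suc) k
enum-true (suc m) p k       | false = enum-true m (p ∘ suc) k

enum-injective : ∀ m (p : Fin m → Bool) {k k′} → enum m p k ≡ enum m p k′ → k ≡ k′
enum-injective (suc m) p {k} {k′} e with p zero
enum-injective (suc m) p {zero}  {zero}   e | true  = refl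
enum-injective (suc m) p {suc k} {suc k′} e | true  = cong suc (enum-injective m (p ∘ suc) (FP.suc-injective e))
enum-injective (suc m) p {k}     {k′}     e | false = enum-injective m (p ∘ suc) (FP.suc-injective e)

enum-surjective : ∀ m (p : Fin m → Bool) x → p x ≡ true → Σ (Fin (count m p)) λ k → enum m p k ≡ x
enum-surjective (suc m) p x px with p zero in p₀
enum-surjective (suc m) p zero    px | true  = zero , refl
enum-surjective (suc m) p (suc x) px | true  = let k , e = enum-surjective m (p ∘ suc) x px in suc k , cong suc e
enum-surjective (suc m) p zero    px | false with () ← trans (sym p₀) px
enum-surjective (suc m) p (suc x) px | false = let k , e = enum-surjective m (p ∘ suc) x px in k , cong suc e

sum-enum : ∀ m (p : Fin m → Bool) (h : Fin m → ℕ) →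
  sumFin (count m p) (h ∘ enum m p) ≡ sumFin m (λ x → 𝟙 (p x) * h x)
sum-enum zero    p h = refl
sum-enum (suc m) p h with p zero
... | true  = cong₂ _+_ (sym (NP.+-identityʳ (h zero))) (sum-enum m (p ∘ suc) (h ∘ suc))
... | false = sum-enum m (p ∘ suc) (h ∘ suc)

count-enum : ∀ m (p q : Fin m → Bool) → count (count m p) (q ∘ enum m p) ≡ count m (λ x → p x ∧ q x)
count-enum m p q = begin
  count (count m p) (q ∘ enum m p)       ≡⟨ count≡sum (count m p) _ ⟩
  sumFin (count m p) (𝟙 ∘ q ∘ enum m p)  ≡⟨ sum-enum m p (𝟙 ∘ q) ⟩
  sumFin m (λ x → 𝟙 (p x) * 𝟙 (q x))     ≡⟨ sum-cong m (λ x → sym (𝟙-∧ (p x) (q x))) ⟩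
  sumFin m (λ x → 𝟙 (p x ∧ q x))         ≡⟨ count≡sum m _ ⟨
  count m (λ x → p x ∧ q x)              ∎
  where open ≡-Reasoning

induced : (G : Graph) → (Fin (n G) → Bool) → Graph
induced G P = record
  { n      = count (n G) P
  ; adj    = λ k k′ → adj G (enum (n G) P k) (enum (n G) P k′)
  ; sym    = λ k k′ → Graph.sym G _ _
  ; irrefl = λ k → irrefl G _
  }

induced⊆ᵢ : ∀ G P → induced G P ⊆ᵢ G
induced⊆ᵢ G P = enum (n G) P , enum-injective (n G) P , λ _ _ → refl

induced⊆ : ∀ G P → induced G P ⊆ G
induced⊆ G P = enum (n G) P , enum-injective (n G) P , λ _ _ e → e

⨁ᶠ : ∀ {m} → (Fin m → Graph) → Graph
⨁ᶠ f = ⨁ (L.tabulate f)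

module _ (G H : Graph) where

  adj-⊕-↑ˡ : ∀ x y → adj (G ⊕ H) (x ↑ˡ n H) (y ↑ˡ n H) ≡ adj G x y
  adj-⊕-↑ˡ x y rewrite splitAt-↑ˡ (n G) x (n H) | splitAt-↑ˡ (n G) y (n H) = refl

  adj-⊕-↑ʳ : ∀ x y → adj (G ⊕ H) (n G ↑ʳ x) (n G ↑ʳ y) ≡ adj H x y
  adj-⊕-↑ʳ x y rewrite splitAt-↑ʳ (n G) (n H) x | splitAt-↑ʳ (n G) (n H) y = refl

  adj-⊕-↑ˡ↑ʳ : ∀ x y → adj (G ⊕ H) (x ↑ˡ n H) (n G ↑ʳ y) ≡ false
  adj-⊕-↑ˡ↑ʳ x y rewrite splitAt-↑ˡ (n G) x (n H) | splitAt-↑ʳ (n G) (n H) y = refl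

  adj-⊕-↑ʳ↑ˡ : ∀ x y → adj (G ⊕ H) (n G ↑ʳ x) (y ↑ˡ n H) ≡ false
  adj-⊕-↑ʳ↑ˡ x y rewrite splitAt-↑ʳ (n G) (n H) x | splitAt-↑ˡ (n G) y (n H) = refl

↑ˡ≢↑ʳ : ∀ {m k} (x : Fin m) (y : Fin k) → x ↑ˡ k ≢ m ↑ʳ y
↑ˡ≢↑ʳ {m} {k} x y e with trans (sym (splitAt-↑ˡ m x k)) (trans (cong (splitAt m) e) (splitAt-↑ʳ m k y))
... | ()

inject : ∀ {m} (f : Fin m → Graph) i → Fin (n (f i)) → Fin (n (⨁ᶠ f))
inject {suc m} f zero    x = x ↑ˡ n (⨁ᶠ (f ∘ suc))
inject {suc m} f (suc i) x = n (f zero) ↑ʳ inject (f ∘ suc) i x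

inject-surjective : ∀ {m} (f : Fin m → Graph) z → Σ (Fin m) λ i → Σ (Fin (n (f i))) λ x → inject f i x ≡ z
inject-surjective {suc m} f z with splitAt (n (f zero)) z in eq
... | inj₁ x = zero , x , splitAt⁻¹-↑ˡ eq
... | inj₂ z′ = let i , x , e = inject-surjective (f ∘ suc) z′
                in suc i , x , trans (cong (n (f zero) ↑ʳ_) e) (splitAt⁻¹-↑ʳ eq)

inject-injective : ∀ {m} (f : Fin m → Graph) {i j x y} → inject f i x ≡ inject f j y →
  _≡_ {A = Σ (Fin m) (Fin ∘ n ∘ f)} (i , x) (j , y)
inject-injective {suc m} f {zero}  {zero}  e rewrite ↑ˡ-injective _ _ _ e = refl
inject-injective {suc m} f {zero}  {suc j} e = ⊥-elim (↑ˡ≢↑ʳ _ _ e)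
inject-injective {suc m} f {suc i} {zero}  e = ⊥-elim (↑ˡ≢↑ʳ _ _ (sym e))
inject-injective {suc m} f {suc i} {suc j} e
  with refl ← inject-injective (f ∘ suc) (↑ʳ-injective (n (f zero)) _ _ e) = refl

inject-injectiveʳ : ∀ {m} (f : Fin m → Graph) i {x y} → inject f i x ≡ inject f i y → x ≡ y
inject-injectiveʳ {suc m} f zero    e = ↑ˡ-injective _ _ _ e
inject-injectiveʳ {suc m} f (suc i) e = inject-injectiveʳ (f ∘ suc) i (↑ʳ-injective (n (f zero)) _ _ e)

adj-inject : ∀ {m} (f : Fin m → Graph) i x y → adj (⨁ᶠ f) (inject f i x) (inject f i y) ≡ adj (f i) x y
adj-inject {suc m} f zero    x y = adj-⊕-↑ˡ (f zero) (⨁ᶠ (f ∘ suc)) x y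
adj-inject {suc m} f (suc i) x y =
  trans (adj-⊕-↑ʳ (f zero) (⨁ᶠ (f ∘ suc)) _ _) (adj-inject (f ∘ suc) i x y)

adj-inject-≢ : ∀ {m} (f : Fin m → Graph) {i j} x y → i ≢ j → adj (⨁ᶠ f) (inject f i x) (inject f j y) ≡ false
adj-inject-≢ {suc m} f {zero}  {zero}  x y i≢j = ⊥-elim (i≢j refl)
adj-inject-≢ {suc m} f {zero}  {suc j} x y _   = adj-⊕-↑ˡ↑ʳ (f zero) (⨁ᶠ (f ∘ suc)) x _
adj-inject-≢ {suc m} f {suc i} {zero}  x y _   = adj-⊕-↑ʳ↑ˡ (f zero) (⨁ᶠ (f ∘ suc)) _ y
adj-inject-≢ {suc m} f {suc i} {suc j} x y i≢j =
  trans (adj-⊕-↑ʳ (f zero) (⨁ᶠ (f ∘ suc)) _ _) (adj-inject-≢ (f ∘ suc) x y (i≢j ∘ cong suc))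

E-inject⇒≡ : ∀ {m} (f : Fin m → Graph) {i j} x y → E (⨁ᶠ f) (inject f i x) (inject f j y) → i ≡ j
E-inject⇒≡ f {i} {j} x y e with i ≟ j
... | yes i≡j = i≡j
... | no  i≢j with () ← trans (sym e) (adj-inject-≢ f x y i≢j)

sum-⨁ᶠ : ∀ {m} (f : Fin m → Graph) (h : Fin (n (⨁ᶠ f)) → ℕ) →
  sumFin (n (⨁ᶠ f)) h ≡ sumFin m (λ i → sumFin (n (f i)) (h ∘ inject f i))
sum-⨁ᶠ {zero}  f h = refl
sum-⨁ᶠ {suc m} f h = trans (sum-↑ (n (f zero)) (n (⨁ᶠ (f ∘ suc))) h)
  (cong (sumFin (n (f zero)) (h ∘ inject f zero) +_) (sum-⨁ᶠ (f ∘ suc) (h ∘ (n (f zero) ↑ʳ_))))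

count-⨁ᶠ : ∀ {m} (f : Fin m → Graph) (p : Fin (n (⨁ᶠ f)) → Bool) →
  count (n (⨁ᶠ f)) p ≡ sumFin m (λ i → count (n (f i)) (p ∘ inject f i))
count-⨁ᶠ {m} f p = begin
  count (n (⨁ᶠ f)) p                                       ≡⟨ count≡sum _ p ⟩
  sumFin (n (⨁ᶠ f)) (𝟙 ∘ p)                                ≡⟨ sum-⨁ᶠ f (𝟙 ∘ p) ⟩
  sumFin m (λ i → sumFin (n (f i)) (𝟙 ∘ p ∘ inject f i))   ≡⟨ sum-cong m (λ i → count≡sum (n (f i)) _) ⟨
  sumFin m (λ i → count (n (f i)) (p ∘ inject f i))        ∎
  where open ≡-Reasoning

copair : ∀ {A : Set} {m} (f : Fin m → Graph) → (∀ i → Fin (n (f i)) → A) → Fin (n (⨁ᶠ f)) → A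
copair {m = zero}  f ψ ()
copair {m = suc m} f ψ z = [ ψ zero , copair (f ∘ suc) (ψ ∘ suc) ]′ (splitAt (n (f zero)) z)

copair-inject : ∀ {A : Set} {m} (f : Fin m → Graph) (ψ : ∀ i → Fin (n (f i)) → A) i x →
  copair f ψ (inject f i x) ≡ ψ i x
copair-inject {m = suc m} f ψ zero    x rewrite splitAt-↑ˡ (n (f zero)) x (n (⨁ᶠ (f ∘ suc))) = refl
copair-inject {m = suc m} f ψ (suc i) x
  rewrite splitAt-↑ʳ (n (f zero)) (n (⨁ᶠ (f ∘ suc))) (inject (f ∘ suc) i x) = copair-inject (f ∘ suc) (ψ ∘ suc) i x

copair-hom : ∀ {m} (f : Fin m → Graph) H (ψ : ∀ i → Fin (n (f i)) → Fin (n H)) →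
  (∀ i → IsHom (f i) H (ψ i)) → IsHom (⨁ᶠ f) H (copair f ψ)
copair-hom f H ψ ψ-hom z z′ e
  with i , x , refl ← inject-surjective f z | j , y , refl ← inject-surjective f z′
  with refl ← E-inject⇒≡ f x y e
  rewrite copair-inject f ψ i x | copair-inject f ψ i y
  = ψ-hom i x y (trans (sym (adj-inject f i x y)) e)

AllIn-tabulate : ∀ {𝒢 : GraphClass} {m} (f : Fin m → Graph) → (∀ i → 𝒢 (f i)) → AllIn 𝒢 (L.tabulate f)
AllIn-tabulate {m = zero}  f f∈𝒢 = []
AllIn-tabulate {m = suc m} f f∈𝒢 = f∈𝒢 zero ∷ AllIn-tabulate (f ∘ suc) (f∈𝒢 ∘ suc)

AllIn-lookup : ∀ {𝒢 : GraphClass} {Gs} → AllIn 𝒢 Gs → ∀ j → 𝒢 (L.lookup Gs j)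
AllIn-lookup (G∈𝒢 ∷ _)    zero    = G∈𝒢
AllIn-lookup (_   ∷ Gs∈𝒢) (suc j) = AllIn-lookup Gs∈𝒢 j

≅-refl : ∀ G → G ≅ G
≅-refl G = id , id , (λ _ → refl) , (λ _ → refl) , (λ _ _ → refl)

⨁ᶠ∈closure : ∀ {𝒢 m} (f : Fin m → Graph) → (∀ i → 𝒢 (f i)) → closure 𝒢 (⨁ᶠ f)
⨁ᶠ∈closure f f∈𝒢 = L.tabulate f , AllIn-tabulate f f∈𝒢 , ≅-refl (⨁ᶠ f)

module Iso {F G : Graph} (iso : F ≅ G) where

  to : Fin (n F) → Fin (n G)
  to = proj₁ iso

  from : Fin (n G) → Fin (n F)
  from = proj₁ (proj₂ iso)

  from-to : ∀ x → from (to x) ≡ x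
  from-to = proj₁ (proj₂ (proj₂ iso))

  to-from : ∀ y → to (from y) ≡ y
  to-from = proj₁ (proj₂ (proj₂ (proj₂ iso)))

  adj-to : ∀ x y → adj F x y ≡ adj G (to x) (to y)
  adj-to = proj₂ (proj₂ (proj₂ (proj₂ iso)))

  adj-from : ∀ p q → adj F (from p) (from q) ≡ adj G p q
  adj-from p q = trans (adj-to (from p) (from q)) (cong₂ (adj G) (to-from p) (to-from q))

  E-to : ∀ {x y} → E F x y → E G (to x) (to y)
  E-to {x} {y} e = trans (sym (adj-to x y)) e

  from-injective : ∀ {p q} → from p ≡ from q → p ≡ q
  from-injective {p} {q} e = trans (sym (to-from p)) (trans (cong to e) (to-from q))

-- The subgraph of ⨁ᶠ f induced by P, built componentwise so that heredity keeps it a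
-- union of members of 𝒢.
module Restriction {m} (f : Fin m → Graph) (P : Fin (n (⨁ᶠ f)) → Bool) where

  part : Fin m → Graph
  part i = induced (f i) (P ∘ inject f i)

  restricted : Graph
  restricted = ⨁ᶠ part

  embedPart : ∀ i → Fin (n (part i)) → Fin (n (⨁ᶠ f))
  embedPart i = inject f i ∘ enum (n (f i)) (P ∘ inject f i)

  embed : Fin (n restricted) → Fin (n (⨁ᶠ f))
  embed = copair part embedPart

  embed-inject : ∀ i k → embed (inject part i k) ≡ embedPart i k
  embed-inject = copair-inject part embedPart

  P-embed : ∀ q → P (embed q) ≡ true
  P-embed q with i , k , refl ← inject-surjective part q rewrite embed-inject i k =
    enum-true (n (f i)) (P ∘ inject f i) k

  embed-injective : ∀ {q q′} → embed q ≡ embed q′ → q ≡ q′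
  embed-injective {q} {q′} e
    with i , k , refl ← inject-surjective part q | j , k′ , refl ← inject-surjective part q′
    rewrite embed-inject i k | embed-inject j k′
    with refl ← cong proj₁ (inject-injective f e)
    = cong (inject part i) (enum-injective _ _ (inject-injectiveʳ f i e))

  adj-embed : ∀ q q′ → adj restricted q q′ ≡ adj (⨁ᶠ f) (embed q) (embed q′)
  adj-embed q q′
    with i , k , refl ← inject-surjective part q | j , k′ , refl ← inject-surjective part q′
    rewrite embed-inject i k | embed-inject j k′
    with i ≟ j
  ... | yes refl = trans (adj-inject part i k k′) (sym (adj-inject f i _ _))
  ... | no  i≢j  = trans (adj-inject-≢ part k k′ i≢j) (sym (adj-inject-≢ f _ _ i≢j))

  embed-onto : ∀ z → P z ≡ true → Σ (Fin (n restricted)) λ q → embed q ≡ z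
  embed-onto z Pz with i , x , refl ← inject-surjective f z
    with k , refl ← enum-surjective (n (f i)) (P ∘ inject f i) x Pz
    = inject part i k , embed-inject i k

  restricted∈closure : ∀ {𝒢} → Hereditary 𝒢 → (∀ i → 𝒢 (f i)) → closure 𝒢 restricted
  restricted∈closure her f∈𝒢 = ⨁ᶠ∈closure part (λ i → her (f i) (part i) (f∈𝒢 i) (induced⊆ᵢ (f i) _))

-- Ordered pairs of R-related vertices inside P; for an adjacency relation this is
-- twice the number of edges of the induced subgraph.
arcs : ∀ N → (Fin N → Fin N → Bool) → (Fin N → Bool) → ℕ
arcs N R P = sumFin N λ x → count N λ y → P x ∧ P y ∧ R x y

arcs≡sum : ∀ N (R : Fin N → Fin N → Bool) P →
  arcs N R P ≡ sumFin N (λ x → 𝟙 (P x) * sumFin N (λ y → 𝟙 (P y) * 𝟙 (R x y)))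
arcs≡sum N R P = sum-cong N λ x → begin
  count N (λ y → P x ∧ P y ∧ R x y)                     ≡⟨ count≡sum N _ ⟩
  sumFin N (λ y → 𝟙 (P x ∧ P y ∧ R x y))
    ≡⟨ sum-cong N (λ y → trans (𝟙-∧ (P x) _) (cong (𝟙 (P x) *_) (𝟙-∧ (P y) (R x y)))) ⟩
  sumFin N (λ y → 𝟙 (P x) * (𝟙 (P y) * 𝟙 (R x y)))      ≡⟨ sum-*ˡ N (𝟙 (P x)) _ ⟩
  𝟙 (P x) * sumFin N (λ y → 𝟙 (P y) * 𝟙 (R x y))        ∎
  where open ≡-Reasoning

arcs-restrict : ∀ N (R : Fin N → Fin N → Bool) (L P : Fin N → Bool) →
  arcs N (λ x y → L x ∧ L y ∧ R x y) P ≡ arcs N R (λ x → P x ∧ L x)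
arcs-restrict N R L P = sum-cong N λ x → count-cong N λ y → regroup (P x) (L x) (P y) (L y) (R x y)
  where
  regroup : ∀ p l p′ l′ e → (p ∧ p′ ∧ l ∧ l′ ∧ e) ≡ ((p ∧ l) ∧ (p′ ∧ l′) ∧ e)
  regroup false l     p′ l′ e = refl
  regroup true  false p′ l′ e = ∧-zeroʳ p′
  regroup true  true  p′ l′ e = sym (∧-assoc p′ l′ e)

forwardAdj : (G : Graph) → Fin (n G) → Fin (n G) → Bool
forwardAdj G u v = if does (toℕ u ℕ.<? toℕ v) then adj G u v else false

𝟙-adj≡forward+backward : ∀ G u v → 𝟙 (adj G u v) ≡ 𝟙 (forwardAdj G u v) + 𝟙 (forwardAdj G v u)
𝟙-adj≡forward+backward G u v with NP.<-cmp (toℕ u) (toℕ v)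
... | tri< u<v _ v≮u rewrite dec-true (toℕ u ℕ.<? toℕ v) u<v | dec-false (toℕ v ℕ.<? toℕ u) v≮u =
  sym (NP.+-identityʳ _)
... | tri> u≮v _ v<u rewrite dec-false (toℕ u ℕ.<? toℕ v) u≮v | dec-true (toℕ v ℕ.<? toℕ u) v<u =
  cong 𝟙 (Graph.sym G u v)
... | tri≈ u≮v u≡v _ rewrite FP.toℕ-injective u≡v | dec-false (toℕ v ℕ.<? toℕ v) u≮v =
  cong 𝟙 (irrefl G v)

handshake : ∀ G → arcs (n G) (adj G) (λ _ → true) ≡ 2 * numEdges G
handshake G = begin
  sumFin N (λ u → count N (adj G u))
    ≡⟨ sum-cong N (λ u → count≡sum N (adj G u)) ⟩
  sumFin N (λ u → sumFin N (λ v → 𝟙 (adj G u v)))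
    ≡⟨ sum-cong N (λ u → sum-cong N (𝟙-adj≡forward+backward G u)) ⟩
  sumFin N (λ u → sumFin N (λ v → 𝟙 (forwardAdj G u v) + 𝟙 (forwardAdj G v u)))
    ≡⟨ sum-cong N (λ u → sum-+ N _ _) ⟩
  sumFin N (λ u → sumFin N (𝟙 ∘ forwardAdj G u) + sumFin N (λ v → 𝟙 (forwardAdj G v u)))
    ≡⟨ sum-+ N _ _ ⟩
  sumFin N (λ u → sumFin N (𝟙 ∘ forwardAdj G u)) + sumFin N (λ u → sumFin N (λ v → 𝟙 (forwardAdj G v u)))
    ≡⟨ cong (sumFin N (λ u → sumFin N (𝟙 ∘ forwardAdj G u)) +_) (sum-swap N N (λ u v → 𝟙 (forwardAdj G v u))) ⟩
  sumFin N (λ u → sumFin N (𝟙 ∘ forwardAdj G u)) + sumFin N (λ v → sumFin N (𝟙 ∘ forwardAdj G v))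
    ≡⟨ cong (λ e → e + e) (sum-cong N (λ u → count≡sum N (forwardAdj G u))) ⟨
  numEdges G + numEdges G
    ≡⟨ cong (numEdges G +_) (NP.+-identityʳ (numEdges G)) ⟨
  2 * numEdges G ∎
  where
  N : ℕ
  N = n G
  open ≡-Reasoning

arcs-induced : ∀ G P → arcs (n G) (adj G) P ≡ arcs (n (induced G P)) (adj (induced G P)) (λ _ → true)
arcs-induced G P = begin
  sumFin N (λ x → count N (λ y → P x ∧ P y ∧ adj G x y))
    ≡⟨ sum-cong N (λ x → guard (P x) x) ⟩
  sumFin N (λ x → 𝟙 (P x) * count N (λ y → P y ∧ adj G x y))
    ≡⟨ sum-enum N P (λ x → count N (λ y → P y ∧ adj G x y)) ⟨
  sumFin (count N P) (λ k → count N (λ y → P y ∧ adj G (enum N P k) y))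
    ≡⟨ sum-cong (count N P) (λ k → count-enum N P (adj G (enum N P k))) ⟨
  sumFin (count N P) (λ k → count (count N P) (λ k′ → adj G (enum N P k) (enum N P k′))) ∎
  where
  N : ℕ
  N = n G
  open ≡-Reasoning
  guard : ∀ b x → count N (λ y → b ∧ P y ∧ adj G x y) ≡ 𝟙 b * count N (λ y → P y ∧ adj G x y)
  guard true  x = sym (NP.+-identityʳ _)
  guard false x = false⇒count≡0 N (λ _ → refl)

mad⇒arcs≤ : ∀ d G → MadAtMost d G → ∀ P →
  ℕtoℚ (arcs (n G) (adj G) P) ℚ.≤ d ℚ.* ℕtoℚ (count (n G) P)
mad⇒arcs≤ d G mad P with count (n G) P ℕ.≟ 0
... | yes #P≡0 = subst₂ (λ a c → ℕtoℚ a ℚ.≤ d ℚ.* ℕtoℚ c) (sym no-arcs) (sym #P≡0)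
  (QP.≤-reflexive (sym (QP.*-zeroʳ d)))
  where
  no-arcs : arcs (n G) (adj G) P ≡ 0
  no-arcs = sum-zeros (n G) λ x → false⇒count≡0 (n G) λ y →
    cong (λ b → b ∧ P y ∧ adj G x y) (count≡0⇒false (n G) #P≡0 x)
... | no  #P≢0 = subst (λ a → ℕtoℚ a ℚ.≤ d ℚ.* ℕtoℚ (count (n G) P))
  (sym (trans (arcs-induced G P) (handshake (induced G P))))
  (mad (induced G P) (induced⊆ G P) (NP.n≢0⇒n>0 #P≢0))

mad-K₂⇒1≤d : ∀ d → MadAtMost d K₂ → ℚ.1ℚ ℚ.≤ d
mad-K₂⇒1≤d d mad = *-cancelʳ-≤-ℕtoℚ 2 (s≤s z≤n)
  (QP.≤-trans (QP.≤-reflexive (QP.*-identityˡ (ℕtoℚ 2))) (mad K₂ (⊆-refl K₂) (s≤s z≤n)))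

arcs-⨁ᶠ : ∀ {m} (f : Fin m → Graph) (P : Fin (n (⨁ᶠ f)) → Bool) →
  arcs (n (⨁ᶠ f)) (adj (⨁ᶠ f)) P ≡ sumFin m (λ i → arcs (n (f i)) (adj (f i)) (P ∘ inject f i))
arcs-⨁ᶠ {m} f P = trans (sum-⨁ᶠ f _) (sum-cong m λ i → sum-cong (n (f i)) λ x →
  trans (count-⨁ᶠ f _) (trans (sum-concentrated m _ i (off i x))
    (count-cong (n (f i)) λ y → cong (λ b → P (inject f i x) ∧ P (inject f i y) ∧ b) (adj-inject f i x y))))
  where
  off : ∀ i x j → i ≢ j →
    count (n (f j)) (λ y → P (inject f i x) ∧ P (inject f j y) ∧ adj (⨁ᶠ f) (inject f i x) (inject f j y)) ≡ 0
  off i x j i≢j = false⇒count≡0 (n (f j)) λ y →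
    trans (cong (λ b → P (inject f i x) ∧ P (inject f j y) ∧ b) (adj-inject-≢ f x y i≢j))
          (trans (cong (P (inject f i x) ∧_) (∧-zeroʳ _)) (∧-zeroʳ _))

mad⇒arcs-⨁ᶠ≤ : ∀ d {m} (f : Fin m → Graph) → (∀ i → MadAtMost d (f i)) → ∀ P →
  ℕtoℚ (arcs (n (⨁ᶠ f)) (adj (⨁ᶠ f)) P) ℚ.≤ d ℚ.* ℕtoℚ (count (n (⨁ᶠ f)) P)
mad⇒arcs-⨁ᶠ≤ d {m} f mad P rewrite arcs-⨁ᶠ f P | count-⨁ᶠ f P =
  ℕtoℚ-sum-≤ d m _ _ (λ i → mad⇒arcs≤ d (f i) (mad i) (P ∘ inject f i))

Degenerate : ∀ N → (Fin N → Fin N → Bool) → ℕ → Set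
Degenerate N R r = ∀ W → 0 < count N W → Σ (Fin N) λ w → W w ≡ true × count N (λ v → W v ∧ R w v) ≤ r

arcs≤⇒degenerate : ∀ N (R : Fin N → Fin N → Bool) r (δ : ℚ) → δ ℚ.< ℕtoℚ (suc r) →
  (∀ W → ℕtoℚ (arcs N R W) ℚ.≤ δ ℚ.* ℕtoℚ (count N W)) → Degenerate N R r
arcs≤⇒degenerate N R r δ δ<1+r arcs≤ W 0<#W
  with any? (λ w → (W w Bool.≟ true) ×-dec (count N (λ v → W v ∧ R w v) ℕ.≤? r))
... | yes (w , Ww , deg≤r) = w , Ww , deg≤r
... | no  ∄w = ⊥-elim (QP.<-irrefl refl (QP.<-≤-trans δ<1+r (*-cancelʳ-≤-ℕtoℚ (count N W) 0<#W (begin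
  ℕtoℚ (suc r) ℚ.* ℕtoℚ (count N W)  ≡⟨ ℕtoℚ-* (suc r) (count N W) ⟨
  ℕtoℚ (suc r * count N W)            ≤⟨ ℕtoℚ-mono-≤ (*-count≤sum N (suc r) W _ high-degree) ⟩
  ℕtoℚ (arcs N R W)                   ≤⟨ arcs≤ W ⟩
  δ ℚ.* ℕtoℚ (count N W)              ∎))))
  where
  open QP.≤-Reasoning
  high-degree : ∀ w → W w ≡ true → suc r ≤ count N (λ v → W w ∧ W v ∧ R w v)
  high-degree w Ww rewrite Ww = NP.≰⇒> (λ deg≤r → ∄w (w , Ww , deg≤r))

unused-colour : ∀ N r (g : Fin N → Bool) (κ : Fin N → Fin (suc r)) → count N g ≤ r →
  Σ (Fin (suc r)) λ c → ∀ v → g v ≡ true → κ v ≢ c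
unused-colour N r g κ #g≤r with any? (λ c → count N (λ v → g v ∧ does (κ v ≟ c)) ℕ.≟ 0)
... | yes (c , #c≡0) = c , unused
  where
  unused : ∀ v → g v ≡ true → κ v ≢ c
  unused v gv κv≡c with () ← trans (sym (count≡0⇒false N #c≡0 v)) (cong₂ _∧_ gv (dec-true (κ v ≟ c) κv≡c))
... | no  ∄c = ⊥-elim (NP.<-irrefl refl (NP.≤-trans (NP.≤-trans every-colour-used (NP.≤-reflexive colour-classes)) #g≤r))
  where
  open ≡-Reasoning
  every-colour-used : suc r ≤ sumFin (suc r) (λ c → count N (λ v → g v ∧ does (κ v ≟ c)))
  every-colour-used = NP.≤-trans (NP.≤-reflexive (sym (NP.*-identityʳ (suc r))))
    (*≤sum (suc r) 1 (λ c → NP.n≢0⇒n>0 (λ #c≡0 → ∄c (c , #c≡0))))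
  colour-classes : sumFin (suc r) (λ c → count N (λ v → g v ∧ does (κ v ≟ c))) ≡ count N g
  colour-classes = begin
    sumFin (suc r) (λ c → count N (λ v → g v ∧ does (κ v ≟ c)))
      ≡⟨ sum-cong (suc r) (λ c → count≡sum N (λ v → g v ∧ does (κ v ≟ c))) ⟩
    sumFin (suc r) (λ c → sumFin N (λ v → 𝟙 (g v ∧ does (κ v ≟ c))))
      ≡⟨ sum-swap (suc r) N (λ c v → 𝟙 (g v ∧ does (κ v ≟ c))) ⟩
    sumFin N (λ v → sumFin (suc r) (λ c → 𝟙 (g v ∧ does (κ v ≟ c))))
      ≡⟨ sum-cong N (λ v → sum-cong (suc r) (λ c → 𝟙-∧ (g v) (does (κ v ≟ c)))) ⟩
    sumFin N (λ v → sumFin (suc r) (λ c → 𝟙 (g v) * 𝟙 (does (κ v ≟ c))))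
      ≡⟨ sum-cong N (λ v → sum-𝟙≟ (suc r) (κ v) (λ _ → 𝟙 (g v))) ⟩
    sumFin N (𝟙 ∘ g)
      ≡⟨ count≡sum N g ⟨
    count N g ∎

module _ {N r : ℕ} (R : Fin N → Fin N → Bool) (R-sym : ∀ w v → R w v ≡ R v w) (R-irrefl : ∀ w → R w w ≡ false) where

  ProperOn : (Fin N → Bool) → (Fin N → Fin (suc r)) → Set
  ProperOn W κ = ∀ w v → W w ≡ true → W v ≡ true → R w v ≡ true → κ w ≢ κ v

  _-_ : (Fin N → Bool) → Fin N → Fin N → Bool
  (W - w) v = W v ∧ not (does (v ≟ w))

  recolour : (Fin N → Fin (suc r)) → Fin N → Fin (suc r) → Fin N → Fin (suc r)
  recolour κ w c v = if does (v ≟ w) then c else κ v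

  recolour-proper : ∀ W w κ c → ProperOn (W - w) κ → (∀ v → (W v ∧ R w v) ≡ true → κ v ≢ c) →
    ProperOn W (recolour κ w c)
  recolour-proper W w κ c κ-proper c-unused v₁ v₂ Wv₁ Wv₂ Rv₁v₂ with v₁ ≟ w | v₂ ≟ w
  ... | yes refl | yes refl with () ← trans (sym Rv₁v₂) (R-irrefl w)
  ... | yes refl | no  _    = λ c≡κv₂ → c-unused v₂ (cong₂ _∧_ Wv₂ Rv₁v₂) (sym c≡κv₂)
  ... | no  _    | yes refl = c-unused v₁ (cong₂ _∧_ Wv₁ (trans (R-sym w v₁) Rv₁v₂))
  ... | no  v₁≢w | no  v₂≢w = κ-proper v₁ v₂ (remains v₁≢w Wv₁) (remains v₂≢w Wv₂) Rv₁v₂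
    where
    remains : ∀ {v} → v ≢ w → W v ≡ true → (W - w) v ≡ true
    remains {v} v≢w Wv = cong₂ _∧_ Wv (cong not (dec-false (v ≟ w) v≢w))

  remove-self : ∀ W w → (W - w) w ≡ false
  remove-self W w = trans (cong (λ b → W w ∧ not b) (dec-true (w ≟ w) refl)) (∧-zeroʳ (W w))

  module _ (degenerate : Degenerate N R r) where

    -- k bounds |W|, which makes the recursion structural.
    colourOn : ∀ k W → count N W ≤ k → Σ (Fin N → Fin (suc r)) (ProperOn W)
    colourOn k W #W≤k with count N W ℕ.≟ 0
    colourOn k       W #W≤k | yes #W≡0 = (λ _ → zero) , empty
      where
      empty : ProperOn W (λ _ → zero)
      empty w _ Ww with () ← trans (sym Ww) (count≡0⇒false N #W≡0 w)
    colourOn zero    W #W≤0 | no  #W≢0 = ⊥-elim (#W≢0 (NP.n≤0⇒n≡0 #W≤0))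
    colourOn (suc k) W #W≤k | no  #W≢0
      with w , Ww , deg≤r ← degenerate W (NP.n≢0⇒n>0 #W≢0)
      with κ , κ-proper ← colourOn k (W - w)
             (NP.≤-pred (NP.≤-trans (count-mono-< N (λ _ → ∧-conicalˡ _ _) w (remove-self W w) Ww) #W≤k))
      with c , c-unused ← unused-colour N r (λ v → W v ∧ R w v) κ deg≤r
      = recolour κ w c , recolour-proper W w κ c κ-proper c-unused

    degenerate⇒colouring : Σ (Fin N → Fin (suc r)) λ κ → ∀ w v → R w v ≡ true → κ w ≢ κ v
    degenerate⇒colouring =
      let κ , κ-proper = colourOn N (λ _ → true) (count≤ N _) in
      κ , λ w v → κ-proper w v refl refl

module FibreRank {M N} (φ : Fin M → Fin N) where

  rank : Fin M → ℕ
  rank z = count M (λ z′ → does (z′ F.<? z) ∧ does (φ z′ ≟ φ z))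

  rank<fibre : ∀ z → rank z < count M (λ z′ → does (φ z′ ≟ φ z))
  rank<fibre z = count-mono-< M (λ _ → ∧-conicalʳ _ _) z
    (cong (_∧ does (φ z ≟ φ z)) (dec-false (z F.<? z) (FP.<-irrefl refl)))
    (dec-true (φ z ≟ φ z) refl)

  rank-mono : ∀ {z z′} → φ z ≡ φ z′ → z F.< z′ → rank z < rank z′
  rank-mono {z} {z′} φz≡φz′ z<z′ = count-mono-< M earlier z
    (cong (_∧ does (φ z ≟ φ z)) (dec-false (z F.<? z) (FP.<-irrefl refl)))
    (cong₂ _∧_ (dec-true (z F.<? z′) z<z′) (dec-true (φ z ≟ φ z′) φz≡φz′))
    where
    earlier : ∀ y → (does (y F.<? z) ∧ does (φ y ≟ φ z)) ≡ true → (does (y F.<? z′) ∧ does (φ y ≟ φ z′)) ≡ true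
    earlier y e = cong₂ _∧_
      (dec-true (y F.<? z′) (FP.<-trans (dec-true⁻¹ (y F.<? z) (∧-conicalˡ _ _ e)) z<z′))
      (dec-true (φ y ≟ φ z′) (trans (dec-true⁻¹ (φ y ≟ φ z) (∧-conicalʳ _ _ e)) φz≡φz′))

  rank-injective : ∀ {z z′} → φ z ≡ φ z′ → rank z ≡ rank z′ → z ≡ z′
  rank-injective {z} {z′} φz≡φz′ rz≡rz′ with FP.<-cmp z z′
  ... | tri< z<z′ _ _ = ⊥-elim (NP.<-irrefl rz≡rz′ (rank-mono φz≡φz′ z<z′))
  ... | tri≈ _ z≡z′ _ = z≡z′
  ... | tri> _ _ z′<z = ⊥-elim (NP.<-irrefl (sym rz≡rz′) (rank-mono (sym φz≡φz′) z′<z))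

  hasRank : ℕ → Fin M → Bool
  hasRank a z = does (rank z ℕ.≟ a)

  count-fibre-hasRank≤1 : ∀ w a → count M (λ z → does (φ z ≟ w) ∧ hasRank a z) ≤ 1
  count-fibre-hasRank≤1 w a = count-≤1 M λ z z′ e e′ → rank-injective
    (trans (dec-true⁻¹ (φ z ≟ w) (∧-conicalˡ _ _ e)) (sym (dec-true⁻¹ (φ z′ ≟ w) (∧-conicalˡ _ _ e′))))
    (trans (dec-true⁻¹ (rank z ℕ.≟ a) (∧-conicalʳ _ _ e)) (sym (dec-true⁻¹ (rank z′ ℕ.≟ a) (∧-conicalʳ _ _ e′))))

  count-fibre-hasRank-∨≤2 : ∀ w a b → count M (λ z → does (φ z ≟ w) ∧ (hasRank a z ∨ hasRank b z)) ≤ 2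
  count-fibre-hasRank-∨≤2 w a b = begin
    count M (λ z → does (φ z ≟ w) ∧ (hasRank a z ∨ hasRank b z))
      ≡⟨ count-cong M (λ z → ∧-distribˡ-∨ (does (φ z ≟ w)) _ _) ⟩
    count M (λ z → (does (φ z ≟ w) ∧ hasRank a z) ∨ (does (φ z ≟ w) ∧ hasRank b z))
      ≤⟨ count-∨ M _ _ ⟩
    count M (λ z → does (φ z ≟ w) ∧ hasRank a z) + count M (λ z → does (φ z ≟ w) ∧ hasRank b z)
      ≤⟨ NP.+-mono-≤ (count-fibre-hasRank≤1 w a) (count-fibre-hasRank≤1 w b) ⟩
    2 ∎
    where open NP.≤-Reasoning

  -- A selector t keeps, over each vertex w, the vertex of rank t w in the fibre of w.
  selection : (Fin N → ℕ) → Fin M → Bool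
  selection t z = hasRank (t (φ z)) z

  selection-injective : ∀ t {z z′} → selection t z ≡ true → selection t z′ ≡ true → φ z ≡ φ z′ → z ≡ z′
  selection-injective t {z} {z′} sz sz′ φz≡φz′ = rank-injective φz≡φz′
    (trans (dec-true⁻¹ (rank z ℕ.≟ _) sz) (trans (cong t φz≡φz′) (sym (dec-true⁻¹ (rank z′ ℕ.≟ _) sz′))))

module Image {M N} (ψ : Fin M → Fin N) (A : Fin M → Fin M → Bool) where

  arcsInto : Fin M → Fin N → ℕ
  arcsInto x v = sumFin M λ y → 𝟙 (does (ψ y ≟ v)) * 𝟙 (A x y)

  multiplicity : Fin N → Fin N → ℕ
  multiplicity w v = sumFin M λ x → 𝟙 (does (ψ x ≟ w)) * arcsInto x v

  image : Fin N → Fin N → Bool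
  image w v = does (1 ℕ.≤? multiplicity w v)

  image-intro : ∀ x y → A x y ≡ true → image (ψ x) (ψ y) ≡ true
  image-intro x y Axy = dec-true (1 ℕ.≤? multiplicity (ψ x) (ψ y)) (begin
    1
      ≡⟨ one ⟨
    𝟙 (does (ψ x ≟ ψ x)) * (𝟙 (does (ψ y ≟ ψ y)) * 𝟙 (A x y))
      ≤⟨ NP.*-monoʳ-≤ (𝟙 (does (ψ x ≟ ψ x))) (≤-sum M (λ y′ → 𝟙 (does (ψ y′ ≟ ψ y)) * 𝟙 (A x y′)) y) ⟩
    𝟙 (does (ψ x ≟ ψ x)) * arcsInto x (ψ y)
      ≤⟨ ≤-sum M (λ x′ → 𝟙 (does (ψ x′ ≟ ψ x)) * arcsInto x′ (ψ y)) x ⟩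
    multiplicity (ψ x) (ψ y) ∎)
    where
    open NP.≤-Reasoning
    one : 𝟙 (does (ψ x ≟ ψ x)) * (𝟙 (does (ψ y ≟ ψ y)) * 𝟙 (A x y)) ≡ 1
    one rewrite dec-true (ψ x ≟ ψ x) refl | dec-true (ψ y ≟ ψ y) refl | Axy = refl

  image-sym : (∀ x y → A x y ≡ A y x) → ∀ w v → image w v ≡ image v w
  image-sym A-sym w v = cong (λ k → does (1 ℕ.≤? k)) (begin
    multiplicity w v
      ≡⟨ sum-cong M (λ x → sum-*ˡ M (⟦ x ⟧ w) _) ⟨
    sumFin M (λ x → sumFin M (λ y → ⟦ x ⟧ w * (⟦ y ⟧ v * 𝟙 (A x y))))
      ≡⟨ sum-swap M M _ ⟩
    sumFin M (λ y → sumFin M (λ x → ⟦ x ⟧ w * (⟦ y ⟧ v * 𝟙 (A x y))))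
      ≡⟨ sum-cong M (λ y → sum-cong M (λ x → swap-factors x y)) ⟩
    sumFin M (λ y → sumFin M (λ x → ⟦ y ⟧ v * (⟦ x ⟧ w * 𝟙 (A y x))))
      ≡⟨ sum-cong M (λ y → sum-*ˡ M (⟦ y ⟧ v) _) ⟩
    multiplicity v w ∎)
    where
    open ≡-Reasoning
    ⟦_⟧ : Fin M → Fin N → ℕ
    ⟦ x ⟧ w = 𝟙 (does (ψ x ≟ w))
    swap-factors : ∀ x y → ⟦ x ⟧ w * (⟦ y ⟧ v * 𝟙 (A x y)) ≡ ⟦ y ⟧ v * (⟦ x ⟧ w * 𝟙 (A y x))
    swap-factors x y = trans (x∙yz≈y∙xz (⟦ x ⟧ w) (⟦ y ⟧ v) (𝟙 (A x y)))
                             (cong (λ b → ⟦ y ⟧ v * (⟦ x ⟧ w * 𝟙 b)) (A-sym x y))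

  image-irrefl : (∀ x y → A x y ≡ true → ψ x ≢ ψ y) → ∀ w → image w w ≡ false
  image-irrefl A-separates w = cong (λ k → does (1 ℕ.≤? k)) (sum-zeros M term≡0)
    where
    arcsInto≡0 : ∀ x → ψ x ≡ w → arcsInto x w ≡ 0
    arcsInto≡0 x ψx≡w = sum-zeros M summand≡0
      where
      summand≡0 : ∀ y → 𝟙 (does (ψ y ≟ w)) * 𝟙 (A x y) ≡ 0
      summand≡0 y with ψ y ≟ w | A x y in Axy
      ... | no  _    | _     = refl
      ... | yes _    | false = refl
      ... | yes ψy≡w | true  = ⊥-elim (A-separates x y Axy (trans ψx≡w (sym ψy≡w)))
    term≡0 : ∀ x → 𝟙 (does (ψ x ≟ w)) * arcsInto x w ≡ 0
    term≡0 x with ψ x ≟ w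
    ... | no  _    = refl
    ... | yes ψx≡w = cong (1 *_) (arcsInto≡0 x ψx≡w)

  -- Weighting each image arc by its multiplicity can only increase the count, and the
  -- weighted count regroups fibre by fibre into the arcs of A.
  arcs-image : ∀ W → arcs N image W ≤ arcs M A (W ∘ ψ)
  arcs-image W = begin
    arcs N image W
      ≡⟨ arcs≡sum N image W ⟩
    sumFin N (λ w → 𝟙 (W w) * sumFin N (λ v → 𝟙 (W v) * 𝟙 (image w v)))
      ≤⟨ sum-mono N (λ w → NP.*-monoʳ-≤ (𝟙 (W w)) (sum-mono N (λ v →
           NP.*-monoʳ-≤ (𝟙 (W v)) (𝟙≤multiplicity w v)))) ⟩
    sumFin N (λ w → 𝟙 (W w) * sumFin N (λ v → 𝟙 (W v) * multiplicity w v))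
      ≡⟨ sum-cong N (λ w → cong (𝟙 (W w) *_) (sum-*-sum-comm N M (𝟙 ∘ W) (λ x → 𝟙 (does (ψ x ≟ w))) arcsInto)) ⟩
    sumFin N (λ w → 𝟙 (W w) * sumFin M (λ x → 𝟙 (does (ψ x ≟ w)) * sumFin N (λ v → 𝟙 (W v) * arcsInto x v)))
      ≡⟨ sum-cong N (λ w → cong (𝟙 (W w) *_) (sum-cong M (λ x →
           cong (𝟙 (does (ψ x ≟ w)) *_) (sum-fibres ψ (𝟙 ∘ W) (𝟙 ∘ A x))))) ⟩
    sumFin N (λ w → 𝟙 (W w) * sumFin M (λ x → 𝟙 (does (ψ x ≟ w)) * sumFin M (λ y → 𝟙 (W (ψ y)) * 𝟙 (A x y))))
      ≡⟨ sum-fibres ψ (𝟙 ∘ W) _ ⟩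
    sumFin M (λ x → 𝟙 (W (ψ x)) * sumFin M (λ y → 𝟙 (W (ψ y)) * 𝟙 (A x y)))
      ≡⟨ arcs≡sum M A (W ∘ ψ) ⟨
    arcs M A (W ∘ ψ) ∎
    where
    open NP.≤-Reasoning
    𝟙≤multiplicity : ∀ w v → 𝟙 (image w v) ≤ multiplicity w v
    𝟙≤multiplicity w v = 𝟙-1≤?-≤ (multiplicity w v)
      where
      𝟙-1≤?-≤ : ∀ k → 𝟙 (does (1 ℕ.≤? k)) ≤ k
      𝟙-1≤?-≤ zero    = z≤n
      𝟙-1≤?-≤ (suc k) = s≤s z≤n

pairsBelow : ℕ → List (ℕ × ℕ)
pairsBelow zero    = []
pairsBelow (suc b) = pairsBelow b ++ L.map (_, b) (L.upTo b)

∈-pairsBelow : ∀ {a b s} → a < b → b < s → (a , b) ∈ pairsBelow s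
∈-pairsBelow {b = b} {s = suc s} a<b (s≤s b≤s) with NP.m≤n⇒m<n∨m≡n b≤s
... | inj₁ b<s  = ∈-++⁺ˡ (∈-pairsBelow a<b b<s)
... | inj₂ refl = ∈-++⁺ʳ (pairsBelow b) (∈-map⁺ (_, b) (∈-upTo⁺ a<b))

length-pairsBelow : ∀ s → 2 * L.length (pairsBelow s) + s ≡ s * s
length-pairsBelow zero    = refl
length-pairsBelow (suc s) = begin
  2 * L.length (pairsBelow s ++ L.map (_, s) (L.upTo s)) + suc s
    ≡⟨ cong (λ k → 2 * k + suc s) (trans (LP.length-++ (pairsBelow s))
         (cong (p +_) (trans (LP.length-map _ (L.upTo s)) (LP.length-upTo s)))) ⟩
  2 * (p + s) + suc s
    ≡⟨ solve 2 (λ p s → con 2 :* (p :+ s) :+ (con 1 :+ s) := (con 2 :* p :+ s) :+ (con 2 :* s :+ con 1)) refl p s ⟩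
  (2 * p + s) + (2 * s + 1)
    ≡⟨ cong (_+ (2 * s + 1)) (length-pairsBelow s) ⟩
  s * s + (2 * s + 1)
    ≡⟨ solve 1 (λ s → s :* s :+ (con 2 :* s :+ con 1) := (con 1 :+ s) :* (con 1 :+ s)) refl s ⟩
  suc s * suc s ∎
  where
  open ≡-Reasoning
  open +-*-Solver
  p : ℕ
  p = L.length (pairsBelow s)

length-concatMap-const : ∀ {A B : Set} (f : A → List B) k → (∀ x → L.length (f x) ≡ k) →
  ∀ xs → L.length (L.concatMap f xs) ≡ L.length xs * k
length-concatMap-const f k len-f []       = refl
length-concatMap-const f k len-f (x ∷ xs) =
  trans (LP.length-++ (f x)) (cong₂ _+_ (len-f x) (length-concatMap-const f k len-f xs))

selectorCount≤ : ∀ s r → 1 ≤ r → s + L.length (pairsBelow s) * suc r ≤ r * (s * s)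
selectorCount≤ s (suc k) _ = begin
  s + p * suc (suc k)                      ≤⟨ NP.m≤m+n _ (p * k + k * s) ⟩
  s + p * suc (suc k) + (p * k + k * s)    ≡⟨ solve 3 (λ s p k → s :+ p :* (con 2 :+ k) :+ (p :* k :+ k :* s)
                                                           := (con 1 :+ k) :* (con 2 :* p :+ s)) refl s p k ⟩
  suc k * (2 * p + s)                      ≡⟨ cong (suc k *_) (length-pairsBelow s) ⟩
  suc k * (s * s)                          ∎
  where
  open NP.≤-Reasoning
  open +-*-Solver
  p : ℕ
  p = L.length (pairsBelow s)

module Flattening {𝒢 : GraphClass} {H : Graph} (C : Cover 𝒢 H) where

  D : Graph
  D = ⨁ᶠ (comp C)

  φD : Fin (n D) → Fin (n H)
  φD = copair (comp C) (φ C)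

  φD-hom : IsHom D H φD
  φD-hom = copair-hom (comp C) H (φ C) (hom C)

  φD-edge-surjective : ∀ u v → E H u v →
    Σ (Fin (n D)) λ z → Σ (Fin (n D)) λ z′ → E D z z′ × φD z ≡ u × φD z′ ≡ v
  φD-edge-surjective u v e with i , x , y , exy , refl , refl ← surj C u v e =
    inject (comp C) i x , inject (comp C) i y , trans (adj-inject (comp C) i x y) exy ,
    copair-inject (comp C) (φ C) i x , copair-inject (comp C) (φ C) i y

  count-fibre≡preimageSize : ∀ v → count (n D) (λ z → does (φD z ≟ v)) ≡ preimageSize C v
  count-fibre≡preimageSize v = trans (count-⨁ᶠ (comp C) _) (sum-cong (t C) λ i → count-cong (n (comp C i)) λ x →
    cong (λ w → does (w ≟ v)) (copair-inject (comp C) (φ C) i x))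

  open FibreRank φD public

  rank<local : ∀ {s} → IsLocal s C → ∀ z → rank z < s
  rank<local loc z = NP.<-≤-trans (rank<fibre z)
    (subst (_≤ _) (sym (count-fibre≡preimageSize (φD z))) (loc (φD z)))

  Selects : (Fin (n H) → ℕ) → Fin (n D) → Fin (n D) → Set
  Selects t z z′ = rank z ≡ t (φD z) × rank z′ ≡ t (φD z′)

  selectors⇒globalInjCover : Hereditary 𝒢 → (ts : List (Fin (n H) → ℕ)) →
    (∀ z z′ → E D z z′ → Any (λ t → Selects t z z′) ts) → HasGlobalInjCover 𝒢 H (L.length ts)
  selectors⇒globalInjCover her ts selected = cover , refl , injective
    where
    module R (k : Fin (L.length ts)) = Restriction (comp C) (selection (L.lookup ts k))

    lift : ∀ u v → E H u v → Σ (Fin (L.length ts)) λ k →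
      Σ (Fin (n (R.restricted k))) λ q → Σ (Fin (n (R.restricted k))) λ q′ →
      E (R.restricted k) q q′ × φD (R.embed k q) ≡ u × φD (R.embed k q′) ≡ v
    lift u v e with z , z′ , ezz′ , refl , refl ← φD-edge-surjective u v e =
      let p = selected z z′ ezz′
          k = Any.index p
          rz , rz′ = AnyP.lookup-index p
          q , q↦z = R.embed-onto k z (dec-true (rank z ℕ.≟ _) rz)
          q′ , q′↦z′ = R.embed-onto k z′ (dec-true (rank z′ ℕ.≟ _) rz′)
      in k , q , q′ , trans (R.adj-embed k q q′) (subst₂ (E D) (sym q↦z) (sym q′↦z′) ezz′) ,
         cong φD q↦z , cong φD q′↦z′

    cover : Cover (closure 𝒢) H
    cover = record
      { t     = L.length ts
      ; comp  = R.restricted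
      ; inCls = λ k → R.restricted∈closure k her (inCls C)
      ; φ     = λ k → φD ∘ R.embed k
      ; hom   = λ k q q′ e → φD-hom _ _ (trans (sym (R.adj-embed k q q′)) e)
      ; surj  = lift
      }

    injective : IsInjective cover
    injective k e = R.embed-injective k
      (selection-injective (L.lookup ts k) (R.P-embed k _) (R.P-embed k _) e)

  module RankPair (a b : ℕ) where

    inPair : Fin (n D) → Bool
    inPair z = hasRank a z ∨ hasRank b z

    open Image φD (λ x y → inPair x ∧ inPair y ∧ adj D x y) public

    count-inPair-over≤ : ∀ W → count (n D) (λ x → W (φD x) ∧ inPair x) ≤ 2 * count (n H) W
    count-inPair-over≤ W = begin
      count (n D) (λ x → W (φD x) ∧ inPair x)
        ≡⟨ trans (count≡sum (n D) _) (sum-cong (n D) (λ x → 𝟙-∧ (W (φD x)) (inPair x))) ⟩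
      sumFin (n D) (λ x → 𝟙 (W (φD x)) * 𝟙 (inPair x))
        ≡⟨ sum-fibres φD (𝟙 ∘ W) (𝟙 ∘ inPair) ⟨
      sumFin (n H) (λ w → 𝟙 (W w) * sumFin (n D) (λ x → 𝟙 (does (φD x ≟ w)) * 𝟙 (inPair x)))
        ≡⟨ sum-cong (n H) (λ w → cong (𝟙 (W w) *_)
             (trans (sum-cong (n D) (λ x → sym (𝟙-∧ _ (inPair x)))) (sym (count≡sum (n D) _)))) ⟩
      sumFin (n H) (λ w → 𝟙 (W w) * count (n D) (λ x → does (φD x ≟ w) ∧ inPair x))
        ≤⟨ sum-mono (n H) (λ w → NP.*-monoʳ-≤ (𝟙 (W w)) (count-fibre-hasRank-∨≤2 w a b)) ⟩
      sumFin (n H) (λ w → 𝟙 (W w) * 2)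
        ≡⟨ trans (sum-cong (n H) (λ w → NP.*-comm (𝟙 (W w)) 2)) (sum-*ˡ (n H) 2 (𝟙 ∘ W)) ⟩
      2 * sumFin (n H) (𝟙 ∘ W)
        ≡⟨ cong (2 *_) (count≡sum (n H) W) ⟨
      2 * count (n H) W ∎
      where open NP.≤-Reasoning

    arcs-image≤ : ∀ d → ℚ.0ℚ ℚ.≤ d → (∀ i → MadAtMost d (comp C i)) → ∀ W →
      ℕtoℚ (arcs (n H) image W) ℚ.≤ (ℕtoℚ 2 ℚ.* d) ℚ.* ℕtoℚ (count (n H) W)
    arcs-image≤ d 0≤d mad W = begin
      ℕtoℚ (arcs (n H) image W)
        ≤⟨ ℕtoℚ-mono-≤ (arcs-image W) ⟩
      ℕtoℚ (arcs (n D) (λ x y → inPair x ∧ inPair y ∧ adj D x y) (W ∘ φD))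
        ≡⟨ cong ℕtoℚ (arcs-restrict (n D) (adj D) inPair (W ∘ φD)) ⟩
      ℕtoℚ (arcs (n D) (adj D) (λ x → W (φD x) ∧ inPair x))
        ≤⟨ mad⇒arcs-⨁ᶠ≤ d (comp C) mad _ ⟩
      d ℚ.* ℕtoℚ (count (n D) (λ x → W (φD x) ∧ inPair x))
        ≤⟨ QP.*-monoˡ-≤-nonNeg d {{ℚ.nonNegative 0≤d}} (ℕtoℚ-mono-≤ (count-inPair-over≤ W)) ⟩
      d ℚ.* ℕtoℚ (2 * count (n H) W)
        ≡⟨ cong (d ℚ.*_) (ℕtoℚ-* 2 (count (n H) W)) ⟩
      d ℚ.* (ℕtoℚ 2 ℚ.* ℕtoℚ (count (n H) W))
        ≡⟨ QP.*-assoc d _ _ ⟨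
      (d ℚ.* ℕtoℚ 2) ℚ.* ℕtoℚ (count (n H) W)
        ≡⟨ cong (ℚ._* ℕtoℚ (count (n H) W)) (QP.*-comm d (ℕtoℚ 2)) ⟩
      (ℕtoℚ 2 ℚ.* d) ℚ.* ℕtoℚ (count (n H) W) ∎
      where open QP.≤-Reasoning

    colouring : ∀ d r → ℚ.0ℚ ℚ.≤ d → (∀ i → MadAtMost d (comp C i)) → ℕtoℚ 2 ℚ.* d ℚ.< ℕtoℚ (suc r) →
      Σ (Fin (n H) → Fin (suc r)) λ κ → ∀ w v → image w v ≡ true → κ w ≢ κ v
    colouring d r 0≤d mad 2d<1+r = degenerate⇒colouring image
      (image-sym λ x y → trans (∧-left-comm (inPair x) (inPair y) (adj D x y))
                               (cong (λ e → inPair y ∧ inPair x ∧ e) (Graph.sym D x y)))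
      (image-irrefl λ x y e → hom-separates {D} {H} {φD} φD-hom x y
                                (∧-conicalʳ (inPair y) (adj D x y) (∧-conicalʳ (inPair x) _ e)))
      (arcs≤⇒degenerate (n H) image r (ℕtoℚ 2 ℚ.* d) 2d<1+r (arcs-image≤ d 0≤d mad))

  module Selectors (s r : ℕ) (κ : ℕ → ℕ → Fin (n H) → Fin (suc r)) where

    -- An edge zz′ between ranks
    -- a < b is kept for c = κ a b (φD z), since φD z and φD z′ are adjacent in the image
    -- graph and so get different colours.
    pairSelector : ℕ → ℕ → Fin (suc r) → Fin (n H) → ℕ
    pairSelector a b c w = if does (κ a b w ≟ c) then a else b

    constSelector : ℕ → Fin (n H) → ℕ
    constSelector a _ = a

    pairSelectors : ℕ × ℕ → List (Fin (n H) → ℕ)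
    pairSelectors (a , b) = L.tabulate (pairSelector a b)

    selectors : List (Fin (n H) → ℕ)
    selectors = L.map constSelector (L.upTo s) ++ L.concatMap pairSelectors (pairsBelow s)

    length-selectors : L.length selectors ≡ s + L.length (pairsBelow s) * suc r
    length-selectors = trans (LP.length-++ (L.map constSelector (L.upTo s)))
      (cong₂ _+_ (trans (LP.length-map constSelector (L.upTo s)) (LP.length-upTo s))
                 (length-concatMap-const pairSelectors (suc r) (λ (a , b) → LP.length-tabulate (pairSelector a b)) (pairsBelow s)))

    module _ (rank<s : ∀ z → rank z < s)
             (κ-proper : ∀ a b w v → RankPair.image a b w v ≡ true → κ a b w ≢ κ a b v) where

      pair-selects : ∀ z z′ → E D z z′ → rank z < rank z′ →
        Any (λ t → Selects t z z′) (L.concatMap pairSelectors (pairsBelow s))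
      pair-selects z z′ e rz<rz′ = AnyP.concatMap⁺ pairSelectors (lose (∈-pairsBelow rz<rz′ (rank<s z′))
        (AnyP.tabulate⁺ {f = pairSelector a b} c (first , second)))
        where
        a b : ℕ
        a = rank z
        b = rank z′
        c : Fin (suc r)
        c = κ a b (φD z)
        first : a ≡ pairSelector a b c (φD z)
        first rewrite dec-true (c ≟ c) refl = refl
        in-pair : (RankPair.inPair a b z ∧ RankPair.inPair a b z′ ∧ adj D z z′) ≡ true
        in-pair rewrite dec-true (a ℕ.≟ a) refl | dec-true (b ℕ.≟ b) refl | ∨-zeroʳ (does (b ℕ.≟ a)) = e
        second : b ≡ pairSelector a b c (φD z′)
        second rewrite dec-false (κ a b (φD z′) ≟ c) (κ-proper a b _ _ (RankPair.image-intro a b z z′ in-pair) ∘ sym) = refl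

      selectors-select : ∀ z z′ → E D z z′ → Any (λ t → Selects t z z′) selectors
      selectors-select z z′ e with NP.<-cmp (rank z) (rank z′)
      ... | tri≈ _ rz≡rz′ _ = AnyP.++⁺ˡ (AnyP.map⁺ (AnyP.applyUpTo⁺ id (refl , sym rz≡rz′) (rank<s z)))
      ... | tri< rz<rz′ _ _ = AnyP.++⁺ʳ _ (pair-selects z z′ e rz<rz′)
      ... | tri> _ _ rz′<rz = AnyP.++⁺ʳ _ (Any.map swap (pair-selects z′ z (trans (Graph.sym D z′ z) e) rz′<rz))

localCover⇒globalInjCover : ∀ {𝒢 H} d r {s} → Hereditary 𝒢 → (∀ G → 𝒢 G → MadAtMost d G) →
  ℚ.0ℚ ℚ.≤ d → ℕtoℚ 2 ℚ.* d ℚ.< ℕtoℚ (suc r) →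
  HasLocalCover 𝒢 H s → HasGlobalInjCover 𝒢 H (s + L.length (pairsBelow s) * suc r)
localCover⇒globalInjCover {H = H} d r {s} her mad 0≤d 2d<1+r (C , loc) =
  subst (HasGlobalInjCover _ _) length-selectors
    (selectors⇒globalInjCover her selectors (selectors-select (rank<local loc) (λ a b → proj₂ (pairColouring a b))))
  where
  open Flattening C
  pairColouring : ∀ a b → Σ (Fin (n H) → Fin (suc r)) λ κ → ∀ w v → RankPair.image a b w v ≡ true → κ w ≢ κ v
  pairColouring a b = RankPair.colouring a b d r 0≤d (λ i → mad (comp C i) (inCls C i)) 2d<1+r
  open Selectors s r (λ a b → proj₁ (pairColouring a b))

edgeless : ℕ → Graph
edgeless k = record { n = k ; adj = λ _ _ → false ; sym = λ _ _ → refl ; irrefl = λ _ → refl }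

module Split {𝒢 : GraphClass} {H : Graph} (C : Cover (closure 𝒢) H) (C-injective : IsInjective C) where

  pieces : Fin (t C) → List Graph
  pieces i = proj₁ (inCls C i)

  piece : ∀ i → Fin (L.length (pieces i)) → Graph
  piece i = L.lookup (pieces i)

  comp≅⨁ᶠ : ∀ i → comp C i ≅ ⨁ᶠ (piece i)
  comp≅⨁ᶠ i = subst (λ Gs → comp C i ≅ ⨁ Gs) (sym (LP.tabulate-lookup (pieces i))) (proj₂ (proj₂ (inCls C i)))

  module I i = Iso {comp C i} {⨁ᶠ (piece i)} (comp≅⨁ᶠ i)

  PieceIndex : Set
  PieceIndex = Σ (Fin (t C)) λ i → Fin (L.length (pieces i))

  -- The vertices of ⨁ᶠ indexGraph enumerate the pieces of all components as a Fin type.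
  indexGraph : Fin (t C) → Graph
  indexGraph i = edgeless (L.length (pieces i))

  index : Fin (n (⨁ᶠ indexGraph)) → PieceIndex
  index k = let i , j , _ = inject-surjective indexGraph k in i , j

  index-inject : ∀ i j → index (inject indexGraph i j) ≡ (i , j)
  index-inject i j = inject-injective indexGraph (proj₂ (proj₂ (inject-surjective indexGraph (inject indexGraph i j))))

  Piece : PieceIndex → Graph
  Piece (i , j) = piece i j

  φPiece : ∀ ij → Fin (n (Piece ij)) → Fin (n H)
  φPiece (i , j) x = φ C i (I.from i (inject (piece i) j x))

  φPiece-hom : ∀ ij → IsHom (Piece ij) H (φPiece ij)
  φPiece-hom (i , j) x y e = hom C i _ _ (trans (I.adj-from i _ _) (trans (adj-inject (piece i) j x y) e))

  Piece∈𝒢 : ∀ ij → 𝒢 (Piece ij)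
  Piece∈𝒢 (i , j) = AllIn-lookup (proj₁ (proj₂ (inCls C i))) j

  EdgeOver : Fin (n H) → Fin (n H) → PieceIndex → Set
  EdgeOver u v ij = Σ (Fin (n (Piece ij))) λ x → Σ (Fin (n (Piece ij))) λ y →
    E (Piece ij) x y × φPiece ij x ≡ u × φPiece ij y ≡ v

  edge-in-piece : ∀ u v → E H u v → Σ PieceIndex (EdgeOver u v)
  edge-in-piece u v e
    with i , x , y , exy , refl , refl ← surj C u v e
    with j , x′ , x′↦ ← inject-surjective (piece i) (I.to i x)
       | j′ , y′ , y′↦ ← inject-surjective (piece i) (I.to i y)
    with refl ← E-inject⇒≡ (piece i) x′ y′ (subst₂ (E (⨁ᶠ (piece i))) (sym x′↦) (sym y′↦) (I.E-to i exy))
    = (i , j) , x′ , y′ ,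
      trans (sym (adj-inject (piece i) j x′ y′)) (subst₂ (E (⨁ᶠ (piece i))) (sym x′↦) (sym y′↦) (I.E-to i exy)) ,
      cong (φ C i) (trans (cong (I.from i) x′↦) (I.from-to i x)) ,
      cong (φ C i) (trans (cong (I.from i) y′↦) (I.from-to i y))

  cover : Cover 𝒢 H
  cover = record
    { t     = n (⨁ᶠ indexGraph)
    ; comp  = Piece ∘ index
    ; inCls = Piece∈𝒢 ∘ index
    ; φ     = φPiece ∘ index
    ; hom   = φPiece-hom ∘ index
    ; surj  = λ u v e → let (i , j) , edge = edge-in-piece u v e in
                inject indexGraph i j , subst (EdgeOver u v) (sym (index-inject i j)) edge
    }

  fibreSize : Fin (n H) → PieceIndex → ℕ
  fibreSize v ij = count (n (Piece ij)) (λ x → does (φPiece ij x ≟ v))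

  local : IsLocal (t C) cover
  local v = begin
    sumFin (n (⨁ᶠ indexGraph)) (fibreSize v ∘ index)
      ≡⟨ sum-⨁ᶠ indexGraph (fibreSize v ∘ index) ⟩
    sumFin (t C) (λ i → sumFin (L.length (pieces i)) (λ j → fibreSize v (index (inject indexGraph i j))))
      ≡⟨ sum-cong (t C) (λ i → sum-cong (L.length (pieces i)) (λ j → cong (fibreSize v) (index-inject i j))) ⟩
    sumFin (t C) (λ i → sumFin (L.length (pieces i)) (λ j → fibreSize v (i , j)))
      ≡⟨ sum-cong (t C) (λ i → count-⨁ᶠ (piece i) (λ p → does (φ C i (I.from i p) ≟ v))) ⟨
    sumFin (t C) (λ i → count (n (⨁ᶠ (piece i))) (λ p → does (φ C i (I.from i p) ≟ v)))
      ≤⟨ sum-≤-* (t C) 1 (λ i → count-≤1 _ (λ p q e e′ → I.from-injective i (C-injective i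
           (trans (dec-true⁻¹ (φ C i (I.from i p) ≟ v) e) (sym (dec-true⁻¹ (φ C i (I.from i q) ≟ v) e′)))))) ⟩
    t C * 1
      ≡⟨ NP.*-identityʳ (t C) ⟩
    t C ∎
    where open NP.≤-Reasoning

globalInjCover⇒localCover : ∀ {𝒢 H u} → HasGlobalInjCover 𝒢 H u → HasLocalCover 𝒢 H u
globalInjCover⇒localCover (C , refl , C-injective) = Split.cover C C-injective , Split.local C C-injective

cf≤cu : ∀ {𝒢 H s u} → IsCf 𝒢 H s → IsCu 𝒢 H u → s ≤ u
cf≤cu (_ , s-least) (global , _) = s-least _ (globalInjCover⇒localCover global)

module _ {𝒢 : GraphClass} (d : ℚ) (her : Hereditary 𝒢) (K₂∈𝒢 : 𝒢 K₂) (mad : ∀ G → 𝒢 G → MadAtMost d G) where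

  private
    δ : ℚ
    δ = ℕtoℚ 2 ℚ.* d

    1≤d : ℚ.1ℚ ℚ.≤ d
    1≤d = mad-K₂⇒1≤d d (mad K₂ K₂∈𝒢)

    0≤d : ℚ.0ℚ ℚ.≤ d
    0≤d = QP.≤-trans (ℕtoℚ-mono-≤ {0} {1} z≤n) 1≤d

    d≤δ : d ℚ.≤ δ
    d≤δ = QP.≤-trans (QP.≤-reflexive (sym (QP.*-identityˡ d)))
                     (QP.*-monoʳ-≤-nonNeg d {{ℚ.nonNegative 0≤d}} (ℕtoℚ-mono-≤ {1} {2} (s≤s z≤n)))

    0≤δ : ℚ.0ℚ ℚ.≤ δ
    0≤δ = QP.≤-trans 0≤d d≤δ

    r : ℕ
    r = proj₁ (ℕtoℚ-floor δ 0≤δ)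

    r≤δ : ℕtoℚ r ℚ.≤ δ
    r≤δ = proj₁ (proj₂ (ℕtoℚ-floor δ 0≤δ))

    δ<1+r : δ ℚ.< ℕtoℚ (suc r)
    δ<1+r = proj₂ (proj₂ (ℕtoℚ-floor δ 0≤δ))

    1≤r : 1 ≤ r
    1≤r = 1≤q<1+r⇒1≤r r (QP.≤-trans 1≤d d≤δ) δ<1+r

  cu≤2d·cf² : ∀ H s u → IsCf 𝒢 H s → IsCu 𝒢 H u → ℕtoℚ u ℚ.≤ δ ℚ.* ℕtoℚ (s * s)
  cu≤2d·cf² H s u (local , _) (_ , u-least) = begin
    ℕtoℚ u                    ≤⟨ ℕtoℚ-mono-≤ (NP.≤-trans (u-least _ global) (selectorCount≤ s r 1≤r)) ⟩
    ℕtoℚ (r * (s * s))        ≡⟨ ℕtoℚ-* r (s * s) ⟩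
    ℕtoℚ r ℚ.* ℕtoℚ (s * s)   ≤⟨ QP.*-monoʳ-≤-nonNeg (ℕtoℚ (s * s)) {{ℕtoℚ-nonNeg (s * s)}} r≤δ ⟩
    δ ℚ.* ℕtoℚ (s * s)        ∎
    where
    open QP.≤-Reasoning
    global = localCover⇒globalInjCover d r her mad 0≤d δ<1+r local

  cuCfBounded : ∀ ℋ → CuCfBounded 𝒢 ℋ
  cuCfBounded ℋ = (λ k → δ ℚ.* ℕtoℚ (k * k)) , bound-nonNeg ,
                  λ H _ s u cf cu → cf≤cu cf cu , cu≤2d·cf² H s u cf cu
    where
    bound-nonNeg : ∀ k → ℚ.0ℚ ℚ.≤ δ ℚ.* ℕtoℚ (k * k)
    bound-nonNeg k = QP.nonNegative⁻¹ _
      {{QP.nonNeg*nonNeg⇒nonNeg δ {{ℚ.nonNegative 0≤δ}} (ℕtoℚ (k * k)) {{ℕtoℚ-nonNeg (k * k)}}}}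

theorem13 : (𝒢 : GraphClass) (d : ℚ) → Hereditary 𝒢 → 𝒢 K₂ → (∀ G → 𝒢 G → MadAtMost d G) →
    (∀ H s u → IsCf 𝒢 H s → IsCu 𝒢 H u → ℕtoℚ u ℚ.≤ ℕtoℚ 2 ℚ.* d ℚ.* ℕtoℚ (s * s))
    × ((ℋ : GraphClass) → CuCfBounded 𝒢 ℋ)
theorem13 𝒢 d her K₂∈𝒢 mad = cu≤2d·cf² d her K₂∈𝒢 mad , cuCfBounded d her K₂∈𝒢 mad
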